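{- The $\mathbb{Q}$-vector space $\mathcal{MD}$ is closed under the ordinary multiplication of formal power series in $\mathbb{Q}[[q]]$, so $(\mathcal{MD},\cdot)$ is a $\mathbb{Q}$-algebra; moreover it is bifiltered by weight and length in the sense that for all $k_1,k_2,l_1,l_2\ge 0$ \[ \mathrm{Fil}^{W,L}_{k_1,l_1}(\mathcal{MD})\cdot \mathrm{Fil}^{W,L}_{k_2,l_2}(\mathcal{MD})\subset \mathrm{Fil}^{W,L}_{k_1+k_2,\,l_1+l_2}(\mathcal{MD}). \]
   Context: For integers $r_1,\dots,r_l\ge 0$ and $n\ge 1$ define the multiple divisor sum $\sigma_{r_1,\dots,r_l}(n)=\sum v_1^{r_1}\cdots v_l^{r_l}$, where the sum runs over all positive integers $u_1>u_2>\dots>u_l>0$ and $v_1,\dots,v_l>0$ with $u_1v_1+\dots+u_lv_l=n$. For integers $s_1,\dots,s_l\ge 1$ the bracket is the formal power series $[s_1,\dots,s_l]=\frac{1}{(s_1-1)!\cdots(s_l-1)!}\sum_{n>0}\sigma_{s_1-1,\dots,s_l-1}(n)q^n\in\mathbb{Q}[[q]]$; its weight is $s_1+\dots+s_l$ and its length is $l$. The empty bracket $[\emptyset]=1$ has weight and length $0$. $\mathcal{MD}$ is the $\mathbb{Q}$-vector space spanned by $1$ and all brackets. $\mathrm{Fil}^{W,L}_{k,l}(\mathcal{MD})$ denotes the $\mathbb{Q}$-span of all brackets (including $1$) of weight $\le k$ and length $\le l$. -}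

module Defs where

open import Data.Nat as ℕ using (ℕ; zero; suc; _≤_; _≤ᵇ_; _≡ᵇ_; _!; _^_; pred)
open import Data.Nat.Properties using (_!≢0; m*n≢0)
open import Data.Bool using (if_then_else_)
open import Data.Integer using (+_)
open import Data.Rational as ℚ using (ℚ)
open import Data.List using (List; []; _∷_; map; length)
open import Data.Nat.ListAction using (sum)
open import Data.List.Relation.Unary.All using (All)
open import Data.Product using (_×_; _,_; Σ; ∃)
open import Relation.Binary.PropositionalEquality using (_≡_)

sum1to : ℕ → (ℕ → ℕ) → ℕ
sum1to zero    f = 0
sum1to (suc m) f = sum1to m f ℕ.+ f (suc m)

-- msd rs b n = Σ v_1^{r_1}⋯v_l^{r_l} over b > u_1 > … > u_l > 0, v_i > 0,
-- with u_1 v_1 + … + u_l v_l = n.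
msd : List ℕ → ℕ → ℕ → ℕ
msd []       b n = if n ≡ᵇ 0 then 1 else 0
msd (r ∷ rs) b n =
  sum1to (pred b) λ u → sum1to n λ v →
    if u ℕ.* v ≤ᵇ n then v ^ r ℕ.* msd rs u (n ℕ.∸ u ℕ.* v) else 0

-- the multiple divisor sum σ_{r_1,…,r_l}(n)  (u_1 ≤ n automatically)
σ : List ℕ → ℕ → ℕ
σ rs n = msd rs (suc n) n

Series : Set
Series = ℕ → ℚ

factProd : List ℕ → ℕ
factProd []      = 1
factProd (s ∷ ss) = pred s ! ℕ.* factProd ss

factProd-nz : (ss : List ℕ) → ℕ.NonZero (factProd ss)
factProd-nz []       = _
factProd-nz (s ∷ ss) = m*n≢0 (pred s !) (factProd ss) {{pred s !≢0}} {{factProd-nz ss}}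

-- the bracket [s_1,…,s_l]; for l = 0 this is the series 1, for l ≥ 1 the
-- coefficient of q^0 is σ(0) = 0, so this matches the paper's sum over n > 0
bracket : List ℕ → Series
bracket ss n = ℚ._/_ (+ σ (map pred ss) n) (factProd ss) {{factProd-nz ss}}

weight : List ℕ → ℕ
weight = sum

sumQ0to : ℕ → (ℕ → ℚ) → ℚ
sumQ0to zero    f = f 0
sumQ0to (suc m) f = sumQ0to m f ℚ.+ f (suc m)

_⋆_ : Series → Series → Series
(f ⋆ g) n = sumQ0to n λ i → f i ℚ.* g (n ℕ.∸ i)

LinComb : Set
LinComb = List (ℚ × List ℕ)

evalLC : LinComb → Series
evalLC []             n = ℚ.0ℚ
evalLC ((c , ss) ∷ t) n = c ℚ.* bracket ss n ℚ.+ evalLC t n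

IsIndex : List ℕ → Set
IsIndex ss = All (1 ≤_) ss

InMD : Series → Set
InMD f = Σ LinComb λ lc →
  All (λ cs → IsIndex (Data.Product.proj₂ cs)) lc × (∀ n → f n ≡ evalLC lc n)

InFil : ℕ → ℕ → Series → Set
InFil k l f = Σ LinComb λ lc →
  All (λ cs → IsIndex (Data.Product.proj₂ cs) ×
              weight (Data.Product.proj₂ cs) ≤ k ×
              length (Data.Product.proj₂ cs) ≤ l) lc
  × (∀ n → f n ≡ evalLC lc n)

-- Write a bracket as (s₁-1)!⁻¹⋯(sₗ-1)!⁻¹ times the series of σ with exponents rᵢ = sᵢ - 1, and
-- truncate the outermost summation index to u₁ < b.  These truncated sums satisfy
--   mds (P ∷ Ps) (b + 1) = mds (P ∷ Ps) b + D_P(b) · mds Ps b,   D_P(u) = Σ_{v ≥ 1} P(v) q^{uv},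
-- so by induction on b the product of two of them splits according to whether the largest u₁ comes
-- from the first factor, from the second, or from both (a quasi-shuffle).  In the last case
-- D_P(u) · D_Q(u) = D_{P⊛Q}(u) with (P ⊛ Q)(V) = Σ_{i+j=V} P(i) Q(j), and for P = v^a, Q = v^c
-- this convolution is, by Faulhaber's formula, a polynomial in V of degree a + c + 1.  Expanding it
-- in monomials v^e gives brackets again, with e + 1 ≤ (a + 1) + (c + 1), so weights and lengths add.

module Submission where

open import Defs
open import Data.Nat using (ℕ; _+_)
open import Data.Product using (_×_)

open import Data.Nat as ℕ using (zero; suc; _*_; _∸_; _^_; _≤_; _<_; z≤n; s≤s; pred; _≡ᵇ_; _≤ᵇ_; _<ᵇ_)
import Data.Nat.Properties as ℕP
import Data.Nat.Solver as ℕSolver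
open import Data.Nat.Combinatorics using (_C_; nC1≡n; nCk+nC[k+1]≡[n+1]C[k+1])
open import Data.Bool using (Bool; true; false; if_then_else_; T; _∧_)
open import Data.Bool.Properties using (T-∧)
open import Data.Integer as ℤ using (+_)
import Data.Integer.Properties as ℤP
import Data.Integer.Solver as ℤSolver
open import Data.Rational as ℚ using (ℚ; 0ℚ; 1ℚ; toℚᵘ) renaming (_+_ to _⊕_; _*_ to _⊗_; -_ to ⊖_)
open import Data.Rational.Literals using (fromℤ)
import Data.Rational.Properties as ℚP
import Data.Rational.Unnormalised as ℚᵘ
import Data.Rational.Unnormalised.Properties as ℚᵘP
open import Data.Rational.Solver using (module +-*-Solver)
open import Data.List using (List; []; _∷_; map; length; _++_)
open import Data.List.Properties using (length-map)
open import Data.List.Relation.Unary.All as All using (All; []; _∷_)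
import Data.List.Relation.Unary.All.Properties as AllP
open import Data.Product using (Σ; _,_; proj₁; proj₂)
open import Data.Sum using (inj₁; inj₂)
open import Data.Empty using (⊥-elim)
open import Relation.Nullary using (¬_)
open import Function.Bundles using (Equivalence)
open import Relation.Binary.PropositionalEquality
open import Relation.Binary.Definitions using (tri<; tri≈; tri>)
open import Level using (0ℓ)
open import Algebra.Bundles using (CommutativeSemigroup)
import Algebra.Properties.CommutativeSemigroup as CommutativeSemigroupProperties

open +-*-Solver using (solve; _:+_; _:*_; :-_; _:=_; con)
open ℕSolver.+-*-Solver using ()
  renaming (solve to ℕsolve; _:+_ to _ℕ:+_; _:*_ to _ℕ:*_; _:=_ to _ℕ:=_; con to ℕcon)
open ℤSolver.+-*-Solver using ()
  renaming (solve to ℤsolve; _:+_ to _ℤ:+_; _:*_ to _ℤ:*_; _:=_ to _ℤ:=_; con to ℤcon)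

ι : ℕ → ℚ
ι m = fromℤ (+ m)

ι-homo-+ : ∀ a b → ι (a + b) ≡ ι a ⊕ ι b
ι-homo-+ a b = ℚP.toℚᵘ-injective (ℚᵘP.≃-sym (ℚᵘP.≃-trans (ℚP.toℚᵘ-homo-+ (ι a) (ι b)) (ℚᵘ.*≡* (trans
  (ℤsolve 2 (λ x y → (x ℤ:* ℤcon (+ 1) ℤ:+ y ℤ:* ℤcon (+ 1)) ℤ:* ℤcon (+ 1) ℤ:= (x ℤ:+ y) ℤ:* (ℤcon (+ 1) ℤ:* ℤcon (+ 1)))
    refl (+ a) (+ b))
  (cong (ℤ._* + 1) (sym (ℤP.pos-+ a b)))))))

ι-homo-* : ∀ a b → ι (a * b) ≡ ι a ⊗ ι b
ι-homo-* a b = ℚP.toℚᵘ-injective (ℚᵘP.≃-sym (ℚᵘP.≃-trans (ℚP.toℚᵘ-homo-* (ι a) (ι b)) (ℚᵘ.*≡*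
  (trans (ℤP.*-identityʳ _) (trans (sym (ℤP.pos-* a b)) (sym (ℤP.*-identityʳ _)))))))

/-*-ι-cancel : ∀ m d .{{_ : ℕ.NonZero d}} → ((+ m) ℚ./ d) ⊗ ι d ≡ ι m
/-*-ι-cancel m (suc d) = ℚP.toℚᵘ-injective (ℚᵘP.≃-trans (ℚP.toℚᵘ-homo-* (+ m ℚ./ suc d) (ι (suc d)))
  (ℚᵘP.≃-trans (ℚᵘP.*-congʳ (ℚP.toℚᵘ-fromℚᵘ (ℚᵘ.mkℚᵘ (+ m) d))) (ℚᵘ.*≡* (ℤP.*-assoc (+ m) (+ suc d) (+ 1)))))

ι⁻¹ : (d : ℕ) .{{_ : ℕ.NonZero d}} → ℚ
ι⁻¹ (suc d) = ℚ.1/ ι (suc d)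

ι⁻¹-inverse : ∀ d .{{_ : ℕ.NonZero d}} → ι⁻¹ d ⊗ ι d ≡ 1ℚ
ι⁻¹-inverse (suc d) = ℚP.*-inverseˡ (ι (suc d))

ι⁻¹-cancel : ∀ d .{{_ : ℕ.NonZero d}} {x y} → x ⊗ ι d ≡ y → x ≡ ι⁻¹ d ⊗ y
ι⁻¹-cancel d {x} {y} x*d≡y = begin
  x                      ≡⟨ ℚP.*-identityˡ x ⟨
  1ℚ ⊗ x                 ≡⟨ cong (_⊗ x) (ι⁻¹-inverse d) ⟨
  (ι⁻¹ d ⊗ ι d) ⊗ x      ≡⟨ solve 3 (λ a b c → (a :* b) :* c := a :* (c :* b)) refl (ι⁻¹ d) (ι d) x ⟩
  ι⁻¹ d ⊗ (x ⊗ ι d)      ≡⟨ cong (ι⁻¹ d ⊗_) x*d≡y ⟩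
  ι⁻¹ d ⊗ y              ∎
  where open ≡-Reasoning

𝟙 : Bool → ℚ
𝟙 true = 1ℚ
𝟙 false = 0ℚ

𝟙-∧ : ∀ b c → 𝟙 b ⊗ 𝟙 c ≡ 𝟙 (b ∧ c)
𝟙-∧ true true = refl
𝟙-∧ true false = refl
𝟙-∧ false c = ℚP.*-zeroˡ (𝟙 c)

𝟙-true : ∀ {b} → T b → 𝟙 b ≡ 1ℚ
𝟙-true {true} _ = refl

𝟙-false : ∀ {b} → ¬ T b → 𝟙 b ≡ 0ℚ
𝟙-false {true} ¬b = ⊥-elim (¬b _)
𝟙-false {false} _ = refl

𝟙-cong : ∀ {b c} → (T b → T c) → (T c → T b) → 𝟙 b ≡ 𝟙 c
𝟙-cong {true} {true} _ _ = refl
𝟙-cong {true} {false} b⇒c _ = ⊥-elim (b⇒c _)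
𝟙-cong {false} {true} _ c⇒b = ⊥-elim (c⇒b _)
𝟙-cong {false} {false} _ _ = refl

Σ< : ℕ → (ℕ → ℚ) → ℚ
Σ< zero f = 0ℚ
Σ< (suc n) f = Σ< n f ⊕ f n

Σ<-cong-< : ∀ n {f g : ℕ → ℚ} → (∀ i → i < n → f i ≡ g i) → Σ< n f ≡ Σ< n g
Σ<-cong-< zero h = refl
Σ<-cong-< (suc n) h = cong₂ _⊕_ (Σ<-cong-< n (λ i i<n → h i (ℕP.m<n⇒m<1+n i<n))) (h n (ℕP.n<1+n n))

Σ<-cong : ∀ n {f g : ℕ → ℚ} → (∀ i → f i ≡ g i) → Σ< n f ≡ Σ< n g
Σ<-cong n h = Σ<-cong-< n (λ i _ → h i)

Σ<-distrib-⊕ : ∀ n (f g : ℕ → ℚ) → Σ< n (λ i → f i ⊕ g i) ≡ Σ< n f ⊕ Σ< n g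
Σ<-distrib-⊕ zero f g = refl
Σ<-distrib-⊕ (suc n) f g = trans (cong (_⊕ (f n ⊕ g n)) (Σ<-distrib-⊕ n f g))
  (solve 4 (λ a b c d → (a :+ b) :+ (c :+ d) := (a :+ c) :+ (b :+ d)) refl (Σ< n f) (Σ< n g) (f n) (g n))

*-distribˡ-Σ< : ∀ n c (f : ℕ → ℚ) → c ⊗ Σ< n f ≡ Σ< n (λ i → c ⊗ f i)
*-distribˡ-Σ< zero c f = ℚP.*-zeroʳ c
*-distribˡ-Σ< (suc n) c f = trans (ℚP.*-distribˡ-+ c (Σ< n f) (f n)) (cong (_⊕ (c ⊗ f n)) (*-distribˡ-Σ< n c f))

*-distribʳ-Σ< : ∀ n c (f : ℕ → ℚ) → Σ< n f ⊗ c ≡ Σ< n (λ i → f i ⊗ c)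
*-distribʳ-Σ< n c f = trans (ℚP.*-comm (Σ< n f) c)
  (trans (*-distribˡ-Σ< n c f) (Σ<-cong n (λ i → ℚP.*-comm c (f i))))

Σ<-zero : ∀ n → Σ< n (λ _ → 0ℚ) ≡ 0ℚ
Σ<-zero zero = refl
Σ<-zero (suc n) = cong (_⊕ 0ℚ) (Σ<-zero n)

Σ<-vanish : ∀ n (f : ℕ → ℚ) → (∀ i → i < n → f i ≡ 0ℚ) → Σ< n f ≡ 0ℚ
Σ<-vanish n f h = trans (Σ<-cong-< n h) (Σ<-zero n)

Σ<-comm : ∀ n m (f : ℕ → ℕ → ℚ) → Σ< n (λ i → Σ< m (f i)) ≡ Σ< m (λ j → Σ< n (λ i → f i j))
Σ<-comm zero m f = sym (Σ<-zero m)
Σ<-comm (suc n) m f = trans (cong (_⊕ Σ< m (f n)) (Σ<-comm n m f))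
  (sym (Σ<-distrib-⊕ m (λ j → Σ< n (λ i → f i j)) (f n)))

Σ<-unshift : ∀ n (f : ℕ → ℚ) → Σ< (suc n) f ≡ f 0 ⊕ Σ< n (λ i → f (suc i))
Σ<-unshift zero f = trans (ℚP.+-identityˡ (f 0)) (sym (ℚP.+-identityʳ (f 0)))
Σ<-unshift (suc n) f = trans (cong (_⊕ f (suc n)) (Σ<-unshift n f))
  (ℚP.+-assoc (f 0) (Σ< n (λ i → f (suc i))) (f (suc n)))

Σ<-reverse : ∀ n (f : ℕ → ℚ) → Σ< n f ≡ Σ< n (λ i → f (n ∸ suc i))
Σ<-reverse zero f = refl
Σ<-reverse (suc n) f = trans (cong (_⊕ f n) (Σ<-reverse n f))
  (trans (ℚP.+-comm (Σ< n (λ i → f (n ∸ suc i))) (f n))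
  (sym (Σ<-unshift n (λ i → f (suc n ∸ suc i)))))

Σ<-truncate : ∀ m n (f : ℕ → ℚ) → m ≤ n → (∀ j → m ≤ j → j < n → f j ≡ 0ℚ) → Σ< n f ≡ Σ< m f
Σ<-truncate m zero f z≤n _ = refl
Σ<-truncate m (suc n) f m≤1+n h with ℕP.m≤n⇒m<n∨m≡n m≤1+n
... | inj₂ refl = refl
... | inj₁ (s≤s m≤n) = trans (cong (Σ< n f ⊕_) (h n m≤n (ℕP.n<1+n n)))
  (trans (ℚP.+-identityʳ (Σ< n f)) (Σ<-truncate m n f m≤n (λ j m≤j j<n → h j m≤j (ℕP.m<n⇒m<1+n j<n))))

Σ<-indicator : ∀ n k (X : ℕ → ℚ) → Σ< n (λ i → 𝟙 (k ≡ᵇ i) ⊗ X i) ≡ 𝟙 (k <ᵇ n) ⊗ X k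
Σ<-indicator zero k X = sym (ℚP.*-zeroˡ (X k))
Σ<-indicator (suc n) k X with ℕP.<-cmp k n
... | tri< k<n _ _ = begin
  Σ< n (λ i → 𝟙 (k ≡ᵇ i) ⊗ X i) ⊕ 𝟙 (k ≡ᵇ n) ⊗ X n
    ≡⟨ cong₂ _⊕_ (Σ<-indicator n k X) (cong (_⊗ X n) (𝟙-false (λ k≡n → ℕP.<-irrefl (ℕP.≡ᵇ⇒≡ k n k≡n) k<n))) ⟩
  𝟙 (k <ᵇ n) ⊗ X k ⊕ 0ℚ ⊗ X n
    ≡⟨ cong₂ _⊕_ (cong (_⊗ X k) (trans (𝟙-true (ℕP.<⇒<ᵇ k<n)) (sym (𝟙-true (ℕP.<⇒<ᵇ (ℕP.m<n⇒m<1+n k<n))))))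
                  (ℚP.*-zeroˡ (X n)) ⟩
  𝟙 (k <ᵇ suc n) ⊗ X k ⊕ 0ℚ
    ≡⟨ ℚP.+-identityʳ _ ⟩
  𝟙 (k <ᵇ suc n) ⊗ X k ∎
  where open ≡-Reasoning
... | tri≈ _ refl _ = begin
  Σ< k (λ i → 𝟙 (k ≡ᵇ i) ⊗ X i) ⊕ 𝟙 (k ≡ᵇ k) ⊗ X k
    ≡⟨ cong₂ _⊕_ (Σ<-indicator k k X) (cong (_⊗ X k) (𝟙-true (ℕP.≡⇒≡ᵇ k k refl))) ⟩
  𝟙 (k <ᵇ k) ⊗ X k ⊕ 1ℚ ⊗ X k
    ≡⟨ cong (λ z → z ⊗ X k ⊕ 1ℚ ⊗ X k) (𝟙-false (λ k<k → ℕP.<-irrefl refl (ℕP.<ᵇ⇒< k k k<k))) ⟩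
  0ℚ ⊗ X k ⊕ 1ℚ ⊗ X k
    ≡⟨ trans (cong (_⊕ 1ℚ ⊗ X k) (ℚP.*-zeroˡ (X k))) (ℚP.+-identityˡ _) ⟩
  1ℚ ⊗ X k
    ≡⟨ cong (_⊗ X k) (sym (𝟙-true (ℕP.<⇒<ᵇ (ℕP.n<1+n k)))) ⟩
  𝟙 (k <ᵇ suc k) ⊗ X k ∎
  where open ≡-Reasoning
... | tri> _ _ n<k = begin
  Σ< n (λ i → 𝟙 (k ≡ᵇ i) ⊗ X i) ⊕ 𝟙 (k ≡ᵇ n) ⊗ X n
    ≡⟨ cong₂ _⊕_ (Σ<-indicator n k X) (cong (_⊗ X n) (𝟙-false (λ k≡n → ℕP.<-irrefl (sym (ℕP.≡ᵇ⇒≡ k n k≡n)) n<k))) ⟩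
  𝟙 (k <ᵇ n) ⊗ X k ⊕ 0ℚ ⊗ X n
    ≡⟨ cong₂ _⊕_ (cong (_⊗ X k) (𝟙-false (λ k<n → ℕP.<-asym n<k (ℕP.<ᵇ⇒< k n k<n)))) (ℚP.*-zeroˡ (X n)) ⟩
  0ℚ ⊗ X k ⊕ 0ℚ
    ≡⟨ ℚP.+-identityʳ _ ⟩
  0ℚ ⊗ X k
    ≡⟨ cong (_⊗ X k) (sym (𝟙-false (λ k<1+n → ℕP.<⇒≱ n<k (ℕP.≤-pred (ℕP.<ᵇ⇒< k (suc n) k<1+n))))) ⟩
  𝟙 (k <ᵇ suc n) ⊗ X k ∎
  where open ≡-Reasoning

Σ<-triangle : ∀ N (T : ℕ → ℕ → ℚ) →
  Σ< N (λ i → Σ< (suc i) (T i)) ≡ Σ< N (λ j → Σ< (N ∸ j) (λ k → T (j + k) j))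
Σ<-triangle zero T = refl
Σ<-triangle (suc N) T = trans (cong (_⊕ Σ< (suc N) (T N)) (Σ<-triangle N T)) (sym columns)
  where
  column : ℕ → ℚ
  column j = Σ< (N ∸ j) (λ k → T (j + k) j)
  column-suc : ∀ j → j < suc N → Σ< (suc N ∸ j) (λ k → T (j + k) j) ≡ column j ⊕ T N j
  column-suc j j<1+N = trans (cong (λ m → Σ< m (λ k → T (j + k) j)) (ℕP.+-∸-assoc 1 (ℕP.≤-pred j<1+N)))
    (cong (λ m → column j ⊕ T m j) (ℕP.m+[n∸m]≡n (ℕP.≤-pred j<1+N)))
  columns : Σ< (suc N) (λ j → Σ< (suc N ∸ j) (λ k → T (j + k) j)) ≡ Σ< N column ⊕ Σ< (suc N) (T N)
  columns = trans (Σ<-cong-< (suc N) column-suc)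
    (trans (Σ<-distrib-⊕ (suc N) column (T N))
    (cong (_⊕ Σ< (suc N) (T N))
      (trans (cong (Σ< N column ⊕_) (cong (λ m → Σ< m (λ k → T (N + k) N)) (ℕP.n∸n≡0 N))) (ℚP.+-identityʳ (Σ< N column)))))

sumQ0to≡Σ< : ∀ n f → sumQ0to n f ≡ Σ< (suc n) f
sumQ0to≡Σ< zero f = sym (ℚP.+-identityˡ (f 0))
sumQ0to≡Σ< (suc n) f = cong (_⊕ f (suc n)) (sumQ0to≡Σ< n f)

ι-sum1to : ∀ n (f : ℕ → ℕ) → ι (sum1to n f) ≡ Σ< n (λ i → ι (f (suc i)))
ι-sum1to zero f = refl
ι-sum1to (suc n) f = trans (ι-homo-+ (sum1to n f) (f (suc n))) (cong (_⊕ ι (f (suc n))) (ι-sum1to n f))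

-- The algebra of formal power series

infix 4 _≈_
_≈_ : Series → Series → Set
f ≈ g = ∀ n → f n ≡ g n

0S : Series
0S _ = 0ℚ

1S : Series
1S zero = 1ℚ
1S (suc _) = 0ℚ

infixl 6 _⊞_
_⊞_ : Series → Series → Series
(f ⊞ g) n = f n ⊕ g n

infixr 7 _·_
_·_ : ℚ → Series → Series
(c · f) n = c ⊗ f n

≈-refl : ∀ {f} → f ≈ f
≈-refl n = refl

≈-sym : ∀ {f g} → f ≈ g → g ≈ f
≈-sym p n = sym (p n)

≈-trans : ∀ {f g h} → f ≈ g → g ≈ h → f ≈ h
≈-trans p q n = trans (p n) (q n)

⊞-cong : ∀ {f f' g g'} → f ≈ f' → g ≈ g' → f ⊞ g ≈ f' ⊞ g'
⊞-cong p q n = cong₂ _⊕_ (p n) (q n)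

⋆-coeff : ∀ f g n → (f ⋆ g) n ≡ Σ< (suc n) (λ i → f i ⊗ g (n ∸ i))
⋆-coeff f g n = sumQ0to≡Σ< n _

⋆-cong : ∀ {f f' g g'} → f ≈ f' → g ≈ g' → f ⋆ g ≈ f' ⋆ g'
⋆-cong {f} {f'} {g} {g'} p q n = trans (⋆-coeff f g n)
  (trans (Σ<-cong (suc n) (λ i → cong₂ _⊗_ (p i) (q (n ∸ i)))) (sym (⋆-coeff f' g' n)))

⋆-comm : ∀ f g → f ⋆ g ≈ g ⋆ f
⋆-comm f g n = trans (⋆-coeff f g n) (trans (Σ<-reverse (suc n) _)
  (trans (Σ<-cong-< (suc n) (λ i i<1+n → trans (cong (λ k → f (n ∸ i) ⊗ g k) (ℕP.m∸[m∸n]≡n (ℕP.≤-pred i<1+n)))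
                                               (ℚP.*-comm (f (n ∸ i)) (g i))))
  (sym (⋆-coeff g f n))))

⋆-assoc : ∀ f g h → (f ⋆ g) ⋆ h ≈ f ⋆ (g ⋆ h)
⋆-assoc f g h n = begin
  ((f ⋆ g) ⋆ h) n
    ≡⟨ ⋆-coeff (f ⋆ g) h n ⟩
  Σ< (suc n) (λ i → (f ⋆ g) i ⊗ h (n ∸ i))
    ≡⟨ Σ<-cong (suc n) (λ i → trans (cong (_⊗ h (n ∸ i)) (⋆-coeff f g i)) (*-distribʳ-Σ< (suc i) (h (n ∸ i)) _)) ⟩
  Σ< (suc n) (λ i → Σ< (suc i) (λ j → (f j ⊗ g (i ∸ j)) ⊗ h (n ∸ i)))
    ≡⟨ Σ<-triangle (suc n) (λ i j → (f j ⊗ g (i ∸ j)) ⊗ h (n ∸ i)) ⟩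
  Σ< (suc n) (λ j → Σ< (suc n ∸ j) (λ k → (f j ⊗ g (j + k ∸ j)) ⊗ h (n ∸ (j + k))))
    ≡⟨ Σ<-cong-< (suc n) inner ⟩
  Σ< (suc n) (λ j → f j ⊗ (g ⋆ h) (n ∸ j))
    ≡⟨ ⋆-coeff f (g ⋆ h) n ⟨
  (f ⋆ (g ⋆ h)) n ∎
  where
  open ≡-Reasoning
  inner : ∀ j → j < suc n →
    Σ< (suc n ∸ j) (λ k → (f j ⊗ g (j + k ∸ j)) ⊗ h (n ∸ (j + k))) ≡ f j ⊗ (g ⋆ h) (n ∸ j)
  inner j j<1+n = begin
    Σ< (suc n ∸ j) (λ k → (f j ⊗ g (j + k ∸ j)) ⊗ h (n ∸ (j + k)))
      ≡⟨ cong (λ m → Σ< m summand) (ℕP.+-∸-assoc 1 (ℕP.≤-pred j<1+n)) ⟩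
    Σ< (suc (n ∸ j)) (λ k → (f j ⊗ g (j + k ∸ j)) ⊗ h (n ∸ (j + k)))
      ≡⟨ Σ<-cong (suc (n ∸ j)) (λ k →
           trans (cong₂ (λ a b → (f j ⊗ g a) ⊗ h b) (ℕP.m+n∸m≡n j k) (sym (ℕP.∸-+-assoc n j k)))
                 (ℚP.*-assoc (f j) (g k) (h (n ∸ j ∸ k)))) ⟩
    Σ< (suc (n ∸ j)) (λ k → f j ⊗ (g k ⊗ h (n ∸ j ∸ k)))
      ≡⟨ *-distribˡ-Σ< (suc (n ∸ j)) (f j) _ ⟨
    f j ⊗ Σ< (suc (n ∸ j)) (λ k → g k ⊗ h (n ∸ j ∸ k))
      ≡⟨ cong (f j ⊗_) (⋆-coeff g h (n ∸ j)) ⟨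
    f j ⊗ (g ⋆ h) (n ∸ j) ∎
    where
    summand : ℕ → ℚ
    summand k = (f j ⊗ g (j + k ∸ j)) ⊗ h (n ∸ (j + k))

⋆-commutativeSemigroup : CommutativeSemigroup 0ℓ 0ℓ
⋆-commutativeSemigroup = record
  { Carrier = Series
  ; _≈_ = _≈_
  ; _∙_ = _⋆_
  ; isCommutativeSemigroup = record
    { isSemigroup = record
      { isMagma = record
        { isEquivalence = record { refl = ≈-refl ; sym = ≈-sym ; trans = ≈-trans }
        ; ∙-cong = ⋆-cong
        }
      ; assoc = ⋆-assoc
      }
    ; comm = ⋆-comm
    }
  }

open CommutativeSemigroupProperties ⋆-commutativeSemigroup using (x∙yz≈y∙xz; interchange)

⋆-distribˡ-⊞ : ∀ f g h → f ⋆ (g ⊞ h) ≈ f ⋆ g ⊞ f ⋆ h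
⋆-distribˡ-⊞ f g h n = trans (⋆-coeff f (g ⊞ h) n)
  (trans (Σ<-cong (suc n) (λ i → ℚP.*-distribˡ-+ (f i) (g (n ∸ i)) (h (n ∸ i))))
  (trans (Σ<-distrib-⊕ (suc n) _ _) (sym (cong₂ _⊕_ (⋆-coeff f g n) (⋆-coeff f h n)))))

⋆-distribʳ-⊞ : ∀ f g h → (g ⊞ h) ⋆ f ≈ g ⋆ f ⊞ h ⋆ f
⋆-distribʳ-⊞ f g h = ≈-trans (⋆-comm (g ⊞ h) f)
  (≈-trans (⋆-distribˡ-⊞ f g h) (⊞-cong (⋆-comm f g) (⋆-comm f h)))

·-⋆-assoc : ∀ c f g → (c · f) ⋆ g ≈ c · (f ⋆ g)
·-⋆-assoc c f g n = trans (⋆-coeff (c · f) g n)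
  (trans (Σ<-cong (suc n) (λ i → ℚP.*-assoc c (f i) (g (n ∸ i))))
  (trans (sym (*-distribˡ-Σ< (suc n) c _)) (cong (c ⊗_) (sym (⋆-coeff f g n)))))

⋆-·-comm : ∀ c f g → f ⋆ (c · g) ≈ c · (f ⋆ g)
⋆-·-comm c f g = ≈-trans (⋆-comm f (c · g)) (≈-trans (·-⋆-assoc c g f) (λ n → cong (c ⊗_) (⋆-comm g f n)))

⋆-zeroˡ : ∀ g → 0S ⋆ g ≈ 0S
⋆-zeroˡ g n = trans (⋆-coeff 0S g n) (Σ<-vanish (suc n) _ (λ i _ → ℚP.*-zeroˡ (g (n ∸ i))))

⋆-zeroʳ : ∀ g → g ⋆ 0S ≈ 0S
⋆-zeroʳ g = ≈-trans (⋆-comm g 0S) (⋆-zeroˡ g)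

⋆-identityˡ : ∀ g → 1S ⋆ g ≈ g
⋆-identityˡ g n = trans (⋆-coeff 1S g n) (trans (Σ<-unshift n _)
  (trans (cong₂ _⊕_ (ℚP.*-identityˡ (g n)) (Σ<-vanish n _ (λ i _ → ℚP.*-zeroˡ (g (n ∸ suc i)))))
  (ℚP.+-identityʳ (g n))))

⋆-identityʳ : ∀ g → g ⋆ 1S ≈ g
⋆-identityʳ g = ≈-trans (⋆-comm g 1S) (⋆-identityˡ g)

-- Dilated series and generalised multiple divisor sums

Weight : Set
Weight = ℕ → ℚ

_⁺ : Weight → Weight
(P ⁺) zero = 0ℚ
(P ⁺) (suc v) = P (suc v)

-- the series Σ_{v ≥ 1} P(v) q^{u v}
dilate : Weight → ℕ → Series
dilate P u i = Σ< (suc i) (λ v → 𝟙 (u * v ≡ᵇ i) ⊗ (P ⁺) v)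

-- mds (P₁ ∷ … ∷ Pₗ) b = Σ_{b > u₁ > … > uₗ > 0} P₁(v₁) ⋯ Pₗ(vₗ) q^{u₁v₁ + … + uₗvₗ}
mds : List Weight → ℕ → Series
mds [] b = 1S
mds (P ∷ Ps) zero = 0S
mds (P ∷ Ps) (suc b) = mds (P ∷ Ps) b ⊞ dilate P b ⋆ mds Ps b

_⊛_ : Weight → Weight → Weight
(P ⊛ Q) V = Σ< (suc V) (λ i → (P ⁺) i ⊗ (Q ⁺) (V ∸ i))

dilate-zero : ∀ P → dilate P 0 ≈ 0S
dilate-zero P zero = trans (ℚP.+-identityˡ _) (ℚP.*-identityˡ 0ℚ)
dilate-zero P (suc i) = Σ<-vanish (suc (suc i)) _ (λ v _ → ℚP.*-zeroˡ ((P ⁺) v))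

dilate-cong : ∀ {P Q} u → (∀ v → (P ⁺) v ≡ (Q ⁺) v) → dilate P u ≈ dilate Q u
dilate-cong u h i = Σ<-cong (suc i) (λ v → cong (𝟙 (u * v ≡ᵇ i) ⊗_) (h v))

dilate-below : ∀ P u i → i < u → dilate P u i ≡ 0ℚ
dilate-below P u i i<u = Σ<-vanish (suc i) _ term
  where
  term : ∀ v → v < suc i → 𝟙 (u * v ≡ᵇ i) ⊗ (P ⁺) v ≡ 0ℚ
  term zero _ = ℚP.*-zeroʳ (𝟙 (u * 0 ≡ᵇ i))
  term (suc v) _ = trans (cong (_⊗ P (suc v)) (𝟙-false (λ uv≡i → ℕP.<-irrefl (sym (ℕP.≡ᵇ⇒≡ _ _ uv≡i))
      (ℕP.<-≤-trans i<u (ℕP.m≤m*n u (suc v)))))) (ℚP.*-zeroˡ (P (suc v)))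

dilate-extend : ∀ P u i n → i ≤ n →
  dilate P (suc u) i ≡ Σ< (suc n) (λ v → 𝟙 (suc u * v ≡ᵇ i) ⊗ (P ⁺) v)
dilate-extend P u i n i≤n = sym (Σ<-truncate (suc i) (suc n) _ (s≤s i≤n) (λ v i<v _ →
  trans (cong (_⊗ (P ⁺) v) (𝟙-false (λ uv≡i → ℕP.<-irrefl (sym (ℕP.≡ᵇ⇒≡ (suc u * v) i uv≡i))
            (ℕP.<-≤-trans i<v (ℕP.m≤n*m v (suc u))))))
        (ℚP.*-zeroˡ ((P ⁺) v))))

dilate-⋆ : ∀ P u G n → (dilate P (suc u) ⋆ G) n
  ≡ Σ< (suc n) (λ v → (P ⁺) v ⊗ (𝟙 (suc u * v <ᵇ suc n) ⊗ G (n ∸ suc u * v)))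
dilate-⋆ P u G n = begin
  (dilate P (suc u) ⋆ G) n
    ≡⟨ ⋆-coeff (dilate P (suc u)) G n ⟩
  Σ< (suc n) (λ i → dilate P (suc u) i ⊗ G (n ∸ i))
    ≡⟨ Σ<-cong-< (suc n) (λ i i<1+n → trans (cong (_⊗ G (n ∸ i)) (dilate-extend P u i n (ℕP.≤-pred i<1+n)))
                                            (*-distribʳ-Σ< (suc n) (G (n ∸ i)) _)) ⟩
  Σ< (suc n) (λ i → Σ< (suc n) (λ v → (𝟙 (suc u * v ≡ᵇ i) ⊗ (P ⁺) v) ⊗ G (n ∸ i)))
    ≡⟨ Σ<-comm (suc n) (suc n) _ ⟩
  Σ< (suc n) (λ v → Σ< (suc n) (λ i → (𝟙 (suc u * v ≡ᵇ i) ⊗ (P ⁺) v) ⊗ G (n ∸ i)))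
    ≡⟨ Σ<-cong (suc n) collapse ⟩
  Σ< (suc n) (λ v → (P ⁺) v ⊗ (𝟙 (suc u * v <ᵇ suc n) ⊗ G (n ∸ suc u * v))) ∎
  where
  open ≡-Reasoning
  collapse : ∀ v → Σ< (suc n) (λ i → (𝟙 (suc u * v ≡ᵇ i) ⊗ (P ⁺) v) ⊗ G (n ∸ i))
                 ≡ (P ⁺) v ⊗ (𝟙 (suc u * v <ᵇ suc n) ⊗ G (n ∸ suc u * v))
  collapse v = trans (Σ<-cong (suc n) (λ i →
      solve 3 (λ a b c → (a :* b) :* c := b :* (a :* c)) refl (𝟙 (suc u * v ≡ᵇ i)) ((P ⁺) v) (G (n ∸ i))))
    (trans (sym (*-distribˡ-Σ< (suc n) ((P ⁺) v) _))
      (cong ((P ⁺) v ⊗_) (Σ<-indicator (suc n) (suc u * v) (λ i → G (n ∸ i)))))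

𝟙-≡ᵇ-split : ∀ u v w n → 𝟙 (u * v <ᵇ suc n) ⊗ 𝟙 (u * w ≡ᵇ n ∸ u * v) ≡ 𝟙 (u * (v + w) ≡ᵇ n)
𝟙-≡ᵇ-split u v w n = trans (𝟙-∧ (u * v <ᵇ suc n) (u * w ≡ᵇ n ∸ u * v)) (𝟙-cong forward backward)
  where
  forward : T ((u * v <ᵇ suc n) ∧ (u * w ≡ᵇ n ∸ u * v)) → T (u * (v + w) ≡ᵇ n)
  forward t with Equivalence.to T-∧ t
  ... | uv<1+n , uw≡n-uv = ℕP.≡⇒≡ᵇ _ _ (begin
    u * (v + w)           ≡⟨ ℕP.*-distribˡ-+ u v w ⟩
    u * v + u * w         ≡⟨ cong (λ z → u * v + z) (ℕP.≡ᵇ⇒≡ _ _ uw≡n-uv) ⟩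
    u * v + (n ∸ u * v)   ≡⟨ ℕP.m+[n∸m]≡n (ℕP.≤-pred (ℕP.<ᵇ⇒< (u * v) (suc n) uv<1+n)) ⟩
    n                     ∎)
    where open ≡-Reasoning
  backward : T (u * (v + w) ≡ᵇ n) → T ((u * v <ᵇ suc n) ∧ (u * w ≡ᵇ n ∸ u * v))
  backward t = Equivalence.from T-∧ (ℕP.<⇒<ᵇ (s≤s (subst (u * v ≤_) split (ℕP.m≤m+n (u * v) (u * w))))
                   , ℕP.≡⇒≡ᵇ _ _ (sym (trans (cong (_∸ u * v) (sym split)) (ℕP.m+n∸m≡n (u * v) (u * w)))))
    where
    split : u * v + u * w ≡ n
    split = trans (sym (ℕP.*-distribˡ-+ u v w)) (ℕP.≡ᵇ⇒≡ _ _ t)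

⊛-⁺ : ∀ P Q V → ((P ⊛ Q) ⁺) V ≡ (P ⊛ Q) V
⊛-⁺ P Q zero = sym (trans (ℚP.+-identityˡ _) (ℚP.*-zeroˡ ((Q ⁺) 0)))
⊛-⁺ P Q (suc V) = refl

dilate-⋆-dilate : ∀ P Q u → dilate P u ⋆ dilate Q u ≈ dilate (P ⊛ Q) u
dilate-⋆-dilate P Q zero = ≈-trans (⋆-cong (dilate-zero P) (≈-refl {dilate Q 0}))
  (≈-trans (⋆-zeroˡ (dilate Q 0)) (≈-sym (dilate-zero (P ⊛ Q))))
dilate-⋆-dilate P Q (suc u) n = trans lhs (sym rhs)
  where
  open ≡-Reasoning
  u' : ℕ
  u' = suc u
  F : ℕ → ℕ → ℚ
  F v w = 𝟙 (u' * (v + w) ≡ᵇ n) ⊗ ((P ⁺) v ⊗ (Q ⁺) w)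

  row : ∀ v → (P ⁺) v ⊗ (𝟙 (u' * v <ᵇ suc n) ⊗ dilate Q u' (n ∸ u' * v)) ≡ Σ< (suc n) (F v)
  row v = begin
    (P ⁺) v ⊗ (a ⊗ dilate Q u' (n ∸ u' * v))
      ≡⟨ cong (λ z → (P ⁺) v ⊗ (a ⊗ z)) (dilate-extend Q u (n ∸ u' * v) n (ℕP.m∸n≤m n (u' * v))) ⟩
    (P ⁺) v ⊗ (a ⊗ Σ< (suc n) (λ w → b w ⊗ (Q ⁺) w))
      ≡⟨ cong ((P ⁺) v ⊗_) (*-distribˡ-Σ< (suc n) a _) ⟩
    (P ⁺) v ⊗ Σ< (suc n) (λ w → a ⊗ (b w ⊗ (Q ⁺) w))
      ≡⟨ *-distribˡ-Σ< (suc n) ((P ⁺) v) _ ⟩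
    Σ< (suc n) (λ w → (P ⁺) v ⊗ (a ⊗ (b w ⊗ (Q ⁺) w)))
      ≡⟨ Σ<-cong (suc n) (λ w → trans
           (solve 4 (λ p a b q → p :* (a :* (b :* q)) := (a :* b) :* (p :* q)) refl ((P ⁺) v) a (b w) ((Q ⁺) w))
           (cong (_⊗ ((P ⁺) v ⊗ (Q ⁺) w)) (𝟙-≡ᵇ-split u' v w n))) ⟩
    Σ< (suc n) (F v) ∎
    where
    a : ℚ
    a = 𝟙 (u' * v <ᵇ suc n)
    b : ℕ → ℚ
    b w = 𝟙 (u' * w ≡ᵇ n ∸ u' * v)

  lhs : (dilate P u' ⋆ dilate Q u') n ≡ Σ< (suc n) (λ v → Σ< (suc n) (F v))
  lhs = trans (dilate-⋆ P u (dilate Q u') n) (Σ<-cong (suc n) row)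

  n<v+k : ∀ v k → suc n ∸ v ≤ k → n < v + k
  n<v+k v k 1+n-v≤k with ℕP.≤-total v (suc n)
  ... | inj₁ v≤1+n = subst (_≤ v + k) (ℕP.m+[n∸m]≡n v≤1+n) (ℕP.+-monoʳ-≤ v 1+n-v≤k)
  ... | inj₂ 1+n≤v = ℕP.≤-trans 1+n≤v (ℕP.m≤m+n v k)

  column : ∀ v → Σ< (suc n ∸ v) (λ k → 𝟙 (u' * (v + k) ≡ᵇ n) ⊗ ((P ⁺) v ⊗ (Q ⁺) (v + k ∸ v)))
               ≡ Σ< (suc n) (F v)
  column v = trans (Σ<-cong (suc n ∸ v) (λ k → cong (λ z → 𝟙 (u' * (v + k) ≡ᵇ n) ⊗ ((P ⁺) v ⊗ (Q ⁺) z)) (ℕP.m+n∸m≡n v k)))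
    (sym (Σ<-truncate (suc n ∸ v) (suc n) (F v) (ℕP.m∸n≤m (suc n) v) (λ k 1+n-v≤k _ →
      trans (cong (_⊗ ((P ⁺) v ⊗ (Q ⁺) k)) (𝟙-false (λ eq → ℕP.<-irrefl (sym (ℕP.≡ᵇ⇒≡ _ _ eq))
              (ℕP.<-≤-trans (n<v+k v k 1+n-v≤k) (ℕP.m≤n*m (v + k) u')))))
      (ℚP.*-zeroˡ ((P ⁺) v ⊗ (Q ⁺) k)))))

  rhs : dilate (P ⊛ Q) u' n ≡ Σ< (suc n) (λ v → Σ< (suc n) (F v))
  rhs = begin
    Σ< (suc n) (λ V → 𝟙 (u' * V ≡ᵇ n) ⊗ ((P ⊛ Q) ⁺) V)
      ≡⟨ Σ<-cong (suc n) (λ V → trans (cong (𝟙 (u' * V ≡ᵇ n) ⊗_) (⊛-⁺ P Q V))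
                                      (*-distribˡ-Σ< (suc V) (𝟙 (u' * V ≡ᵇ n)) _)) ⟩
    Σ< (suc n) (λ V → Σ< (suc V) (λ v → 𝟙 (u' * V ≡ᵇ n) ⊗ ((P ⁺) v ⊗ (Q ⁺) (V ∸ v))))
      ≡⟨ Σ<-triangle (suc n) (λ V v → 𝟙 (u' * V ≡ᵇ n) ⊗ ((P ⁺) v ⊗ (Q ⁺) (V ∸ v))) ⟩
    Σ< (suc n) (λ v → Σ< (suc n ∸ v) (λ k → 𝟙 (u' * (v + k) ≡ᵇ n) ⊗ ((P ⁺) v ⊗ (Q ⁺) (v + k ∸ v))))
      ≡⟨ Σ<-cong (suc n) column ⟩
    Σ< (suc n) (λ v → Σ< (suc n) (F v)) ∎

mds-stable : ∀ Ps b n → n < b → mds Ps (suc b) n ≡ mds Ps b n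
mds-stable [] b n _ = refl
mds-stable (P ∷ Ps) b n n<b = trans (cong (mds (P ∷ Ps) b n ⊕_)
  (trans (⋆-coeff (dilate P b) (mds Ps b) n) (Σ<-vanish (suc n) _ (λ i i<1+n →
    trans (cong (_⊗ mds Ps b (n ∸ i)) (dilate-below P b i (ℕP.≤-<-trans (ℕP.≤-pred i<1+n) n<b)))
          (ℚP.*-zeroˡ (mds Ps b (n ∸ i)))))))
  (ℚP.+-identityʳ _)

mds-stable-+ : ∀ Ps b k n → n < b → mds Ps (k + b) n ≡ mds Ps b n
mds-stable-+ Ps b zero n _ = refl
mds-stable-+ Ps b (suc k) n n<b =
  trans (mds-stable Ps (k + b) n (ℕP.<-≤-trans n<b (ℕP.m≤n+m b k))) (mds-stable-+ Ps b k n n<b)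

mds-stable-≤ : ∀ Ps m n → m ≤ n → mds Ps (suc m) m ≡ mds Ps (suc n) m
mds-stable-≤ Ps m n m≤n = trans (sym (mds-stable-+ Ps (suc m) (n ∸ m) m (ℕP.n<1+n m)))
  (cong (λ k → mds Ps k m) (trans (ℕP.+-suc (n ∸ m) m) (cong suc (ℕP.m∸n+n≡m m≤n))))

mono : ℕ → Weight
mono r v = ι (v ^ r)

≤ᵇ≡<ᵇ-suc : ∀ m n → (m ≤ᵇ n) ≡ (m <ᵇ suc n)
≤ᵇ≡<ᵇ-suc zero n = refl
≤ᵇ≡<ᵇ-suc (suc m) n = refl

ι-if : ∀ b x y → ι (if b then x * y else 0) ≡ ι x ⊗ (𝟙 b ⊗ ι y)
ι-if true x y = trans (ι-homo-* x y) (cong (ι x ⊗_) (sym (ℚP.*-identityˡ (ι y))))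
ι-if false x y = sym (trans (cong (ι x ⊗_) (ℚP.*-zeroˡ (ι y))) (ℚP.*-zeroʳ (ι x)))

ι-msd : ∀ rs b n → ι (msd rs b n) ≡ mds (map mono rs) b n
ι-msd [] b zero = refl
ι-msd [] b (suc n) = refl
ι-msd (r ∷ rs) zero n = refl
ι-msd (r ∷ rs) (suc zero) n = sym (trans (cong (0ℚ ⊕_)
    (trans (⋆-cong (dilate-zero (mono r)) (≈-refl {mds (map mono rs) 0}) n) (⋆-zeroˡ (mds (map mono rs) 0) n)))
  (ℚP.+-identityˡ 0ℚ))
ι-msd (r ∷ rs) (suc (suc u)) n =
  trans (ι-homo-+ (msd (r ∷ rs) (suc u) n) (sum1to n term))
        (cong₂ _⊕_ (ι-msd (r ∷ rs) (suc u) n) (sym new-row))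
  where
  G : Series
  G = mds (map mono rs) (suc u)
  term : ℕ → ℕ
  term v = if suc u * v ≤ᵇ n then v ^ r * msd rs (suc u) (n ∸ suc u * v) else 0
  ι-term : ∀ v → mono r (suc v) ⊗ (𝟙 (suc u * suc v <ᵇ suc n) ⊗ G (n ∸ suc u * suc v)) ≡ ι (term (suc v))
  ι-term v = sym (trans (ι-if (suc u * suc v ≤ᵇ n) (suc v ^ r) (msd rs (suc u) (n ∸ suc u * suc v)))
    (cong₂ (λ b z → mono r (suc v) ⊗ (𝟙 b ⊗ z)) (≤ᵇ≡<ᵇ-suc (suc u * suc v) n) (ι-msd rs (suc u) (n ∸ suc u * suc v))))
  new-row : (dilate (mono r) (suc u) ⋆ G) n ≡ ι (sum1to n term)
  new-row = begin
    (dilate (mono r) (suc u) ⋆ G) n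
      ≡⟨ dilate-⋆ (mono r) u G n ⟩
    Σ< (suc n) (λ v → (mono r ⁺) v ⊗ (𝟙 (suc u * v <ᵇ suc n) ⊗ G (n ∸ suc u * v)))
      ≡⟨ Σ<-unshift n _ ⟩
    0ℚ ⊗ (𝟙 (suc u * 0 <ᵇ suc n) ⊗ G (n ∸ suc u * 0)) ⊕ rest
      ≡⟨ trans (cong (_⊕ rest) (ℚP.*-zeroˡ (𝟙 (suc u * 0 <ᵇ suc n) ⊗ G (n ∸ suc u * 0)))) (ℚP.+-identityˡ rest) ⟩
    Σ< n (λ v → mono r (suc v) ⊗ (𝟙 (suc u * suc v <ᵇ suc n) ⊗ G (n ∸ suc u * suc v)))
      ≡⟨ Σ<-cong n ι-term ⟩
    Σ< n (λ v → ι (term (suc v)))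
      ≡⟨ ι-sum1to n term ⟨
    ι (sum1to n term) ∎
    where
    open ≡-Reasoning
    rest : ℚ
    rest = Σ< n (λ v → mono r (suc v) ⊗ (𝟙 (suc u * suc v <ᵇ suc n) ⊗ G (n ∸ suc u * suc v)))

σ-series : List ℕ → Series
σ-series rs n = mds (map mono rs) (suc n) n

bracket-σ-series : ∀ ss n → bracket ss n ⊗ ι (factProd ss) ≡ σ-series (map pred ss) n
bracket-σ-series ss n = trans (/-*-ι-cancel (σ (map pred ss) n) (factProd ss) {{factProd-nz ss}})
  (ι-msd (map pred ss) (suc n) n)

-- Polynomial weights

Poly : Set
Poly = List (ℚ × ℕ)

⟦_⟧ : Poly → Weight
⟦ [] ⟧ v = 0ℚ
⟦ (c , e) ∷ p ⟧ v = c ⊗ mono e v ⊕ ⟦ p ⟧ v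

DegreeAtMost : ℕ → Poly → Set
DegreeAtMost d p = All (λ ce → proj₂ ce ≤ d) p

degree-mono : ∀ {d d'} → d ≤ d' → ∀ {p} → DegreeAtMost d p → DegreeAtMost d' p
degree-mono d≤d' = All.map (λ e≤d → ℕP.≤-trans e≤d d≤d')

Polynomial : ℕ → Weight → Set
Polynomial d f = Σ Poly (λ p → DegreeAtMost d p × (∀ V → 1 ≤ V → ⟦ p ⟧ V ≡ f V))

⟦⟧-++ : ∀ p q v → ⟦ p ++ q ⟧ v ≡ ⟦ p ⟧ v ⊕ ⟦ q ⟧ v
⟦⟧-++ [] q v = sym (ℚP.+-identityˡ _)
⟦⟧-++ ((c , e) ∷ p) q v = trans (cong (c ⊗ mono e v ⊕_) (⟦⟧-++ p q v))
  (sym (ℚP.+-assoc (c ⊗ mono e v) (⟦ p ⟧ v) (⟦ q ⟧ v)))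

scalePoly : ℚ → Poly → Poly
scalePoly k = map (λ ce → (k ⊗ proj₁ ce , proj₂ ce))

⟦⟧-scale : ∀ k p v → ⟦ scalePoly k p ⟧ v ≡ k ⊗ ⟦ p ⟧ v
⟦⟧-scale k [] v = sym (ℚP.*-zeroʳ k)
⟦⟧-scale k ((c , e) ∷ p) v = trans (cong ((k ⊗ c) ⊗ mono e v ⊕_) (⟦⟧-scale k p v))
  (solve 4 (λ k c m r → (k :* c) :* m :+ k :* r := k :* (c :* m :+ r)) refl k c (mono e v) (⟦ p ⟧ v))

degree-scale : ∀ {d} k {p} → DegreeAtMost d p → DegreeAtMost d (scalePoly k p)
degree-scale k h = AllP.map⁺ h

raise : Poly → Poly
raise = map (λ ce → (proj₁ ce , suc (proj₂ ce)))

mono-suc : ∀ e v → mono (suc e) v ≡ ι v ⊗ mono e v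
mono-suc e v = ι-homo-* v (v ^ e)

⟦⟧-raise : ∀ p v → ⟦ raise p ⟧ v ≡ ι v ⊗ ⟦ p ⟧ v
⟦⟧-raise [] v = sym (ℚP.*-zeroʳ (ι v))
⟦⟧-raise ((c , e) ∷ p) v = trans (cong₂ _⊕_ (cong (c ⊗_) (mono-suc e v)) (⟦⟧-raise p v))
  (solve 4 (λ c x m r → c :* (x :* m) :+ x :* r := x :* (c :* m :+ r)) refl c (ι v) (mono e v) (⟦ p ⟧ v))

degree-raise : ∀ {d p} → DegreeAtMost d p → DegreeAtMost (suc d) (raise p)
degree-raise h = AllP.map⁺ (All.map s≤s h)

x*C-recurrence : ∀ V j → V * (V C j) ≡ suc j * (V C suc j) + j * (V C j)
x*C-recurrence zero zero = refl
x*C-recurrence zero (suc j) = sym (cong₂ _+_ (ℕP.*-zeroʳ (suc (suc j))) (ℕP.*-zeroʳ (suc j)))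
x*C-recurrence (suc V) zero = trans (ℕP.*-identityʳ (suc V)) (sym (trans (ℕP.+-identityʳ _) (trans (ℕP.+-identityʳ _) (nC1≡n (suc V)))))
x*C-recurrence (suc V) (suc j) = begin
  suc V * (suc V C suc j)
    ≡⟨ cong (suc V *_) (sym (nCk+nC[k+1]≡[n+1]C[k+1] V j)) ⟩
  suc V * (x + y)
    ≡⟨ ℕsolve 3 (λ V x y → (ℕcon 1 ℕ:+ V) ℕ:* (x ℕ:+ y) ℕ:= x ℕ:+ y ℕ:+ (V ℕ:* x ℕ:+ V ℕ:* y)) refl V x y ⟩
  x + y + (V * x + V * y)
    ≡⟨ cong₂ (λ a b → x + y + (a + b)) (x*C-recurrence V j) (x*C-recurrence V (suc j)) ⟩
  x + y + ((suc j * y + j * x) + (suc (suc j) * z + suc j * y))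
    ≡⟨ ℕsolve 4 (λ j x y z →
         x ℕ:+ y ℕ:+ (((ℕcon 1 ℕ:+ j) ℕ:* y ℕ:+ j ℕ:* x) ℕ:+ ((ℕcon 2 ℕ:+ j) ℕ:* z ℕ:+ (ℕcon 1 ℕ:+ j) ℕ:* y))
         ℕ:= (ℕcon 2 ℕ:+ j) ℕ:* (y ℕ:+ z) ℕ:+ (ℕcon 1 ℕ:+ j) ℕ:* (x ℕ:+ y)) refl j x y z ⟩
  suc (suc j) * (y + z) + suc j * (x + y)
    ≡⟨ cong₂ (λ a b → suc (suc j) * a + suc j * b) (nCk+nC[k+1]≡[n+1]C[k+1] V (suc j)) (nCk+nC[k+1]≡[n+1]C[k+1] V j) ⟩
  suc (suc j) * (suc V C suc (suc j)) + suc j * (suc V C suc j) ∎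
  where
  open ≡-Reasoning
  x y z : ℕ
  x = V C j
  y = V C suc j
  z = V C suc (suc j)

ι-x*C-recurrence : ∀ V j → ι V ⊗ ι (V C j) ≡ ι (suc j) ⊗ ι (V C suc j) ⊕ ι j ⊗ ι (V C j)
ι-x*C-recurrence V j = begin
  ι V ⊗ ι (V C j)                                   ≡⟨ ι-homo-* V (V C j) ⟨
  ι (V * (V C j))                                   ≡⟨ cong ι (x*C-recurrence V j) ⟩
  ι (suc j * (V C suc j) + j * (V C j))             ≡⟨ ι-homo-+ (suc j * (V C suc j)) (j * (V C j)) ⟩
  ι (suc j * (V C suc j)) ⊕ ι (j * (V C j))         ≡⟨ cong₂ _⊕_ (ι-homo-* (suc j) (V C suc j)) (ι-homo-* j (V C j)) ⟩
  ι (suc j) ⊗ ι (V C suc j) ⊕ ι j ⊗ ι (V C j)       ∎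
  where open ≡-Reasoning

⟦_⟧ᶜ : Poly → Weight
⟦ [] ⟧ᶜ V = 0ℚ
⟦ (c , j) ∷ B ⟧ᶜ V = c ⊗ ι (V C j) ⊕ ⟦ B ⟧ᶜ V

timesX : Poly → Poly
timesX [] = []
timesX ((c , j) ∷ B) = (c ⊗ ι (suc j) , suc j) ∷ (c ⊗ ι j , j) ∷ timesX B

⟦⟧ᶜ-timesX : ∀ B V → ⟦ timesX B ⟧ᶜ V ≡ ι V ⊗ ⟦ B ⟧ᶜ V
⟦⟧ᶜ-timesX [] V = sym (ℚP.*-zeroʳ (ι V))
⟦⟧ᶜ-timesX ((c , j) ∷ B) V = begin
  (c ⊗ ι (suc j)) ⊗ ι (V C suc j) ⊕ ((c ⊗ ι j) ⊗ ι (V C j) ⊕ ⟦ timesX B ⟧ᶜ V)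
    ≡⟨ cong (λ r → (c ⊗ ι (suc j)) ⊗ ι (V C suc j) ⊕ ((c ⊗ ι j) ⊗ ι (V C j) ⊕ r)) (⟦⟧ᶜ-timesX B V) ⟩
  (c ⊗ ι (suc j)) ⊗ ι (V C suc j) ⊕ ((c ⊗ ι j) ⊗ ι (V C j) ⊕ ι V ⊗ ⟦ B ⟧ᶜ V)
    ≡⟨ solve 6 (λ c a b₁ d b₀ r → (c :* a) :* b₁ :+ ((c :* d) :* b₀ :+ r) := c :* (a :* b₁ :+ d :* b₀) :+ r) refl
         c (ι (suc j)) (ι (V C suc j)) (ι j) (ι (V C j)) (ι V ⊗ ⟦ B ⟧ᶜ V) ⟩
  c ⊗ (ι (suc j) ⊗ ι (V C suc j) ⊕ ι j ⊗ ι (V C j)) ⊕ ι V ⊗ ⟦ B ⟧ᶜ V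
    ≡⟨ cong (λ t → c ⊗ t ⊕ ι V ⊗ ⟦ B ⟧ᶜ V) (ι-x*C-recurrence V j) ⟨
  c ⊗ (ι V ⊗ ι (V C j)) ⊕ ι V ⊗ ⟦ B ⟧ᶜ V
    ≡⟨ solve 4 (λ c v b r → c :* (v :* b) :+ v :* r := v :* (c :* b :+ r)) refl c (ι V) (ι (V C j)) (⟦ B ⟧ᶜ V) ⟩
  ι V ⊗ ⟦ (c , j) ∷ B ⟧ᶜ V ∎
  where open ≡-Reasoning

degree-timesX : ∀ {d} B → DegreeAtMost d B → DegreeAtMost (suc d) (timesX B)
degree-timesX [] [] = []
degree-timesX (_ ∷ B) (j≤d ∷ h) = s≤s j≤d ∷ ℕP.m≤n⇒m≤1+n j≤d ∷ degree-timesX B h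

mono-binomial : ∀ a → Σ Poly (λ B → DegreeAtMost a B × (∀ V → mono a V ≡ ⟦ B ⟧ᶜ V))
mono-binomial zero = ((1ℚ , 0) ∷ []) , (z≤n ∷ []) , (λ V → sym (trans (ℚP.+-identityʳ _) (ℚP.*-identityˡ _)))
mono-binomial (suc a) with mono-binomial a
... | B , deg , eq = timesX B , degree-timesX B deg ,
  (λ V → trans (mono-suc a V) (trans (cong (ι V ⊗_) (eq V)) (sym (⟦⟧ᶜ-timesX B V))))

Σ<-C : ∀ V j → Σ< V (λ i → ι (i C j)) ≡ ι (V C suc j)
Σ<-C zero j = refl
Σ<-C (suc V) j = begin
  Σ< V (λ i → ι (i C j)) ⊕ ι (V C j)  ≡⟨ cong (_⊕ ι (V C j)) (Σ<-C V j) ⟩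
  ι (V C suc j) ⊕ ι (V C j)           ≡⟨ ℚP.+-comm (ι (V C suc j)) (ι (V C j)) ⟩
  ι (V C j) ⊕ ι (V C suc j)           ≡⟨ ι-homo-+ (V C j) (V C suc j) ⟨
  ι (V C j + V C suc j)               ≡⟨ cong ι (nCk+nC[k+1]≡[n+1]C[k+1] V j) ⟩
  ι (suc V C suc j)                   ∎
  where open ≡-Reasoning

Σ<-⟦⟧ᶜ : ∀ B V → Σ< V ⟦ B ⟧ᶜ ≡ ⟦ raise B ⟧ᶜ V
Σ<-⟦⟧ᶜ [] V = Σ<-zero V
Σ<-⟦⟧ᶜ ((c , j) ∷ B) V = trans (Σ<-distrib-⊕ V (λ i → c ⊗ ι (i C j)) ⟦ B ⟧ᶜ)
  (cong₂ _⊕_ (trans (sym (*-distribˡ-Σ< V c (λ i → ι (i C j)))) (cong (c ⊗_) (Σ<-C V j))) (Σ<-⟦⟧ᶜ B V))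

polynomial-cong : ∀ {d f g} → (∀ V → 1 ≤ V → f V ≡ g V) → Polynomial d f → Polynomial d g
polynomial-cong f≡g (p , deg , eq) = p , deg , (λ V 1≤V → trans (eq V 1≤V) (f≡g V 1≤V))

polynomial-mono : ∀ {d d' f} → d ≤ d' → Polynomial d f → Polynomial d' f
polynomial-mono d≤d' (p , deg , eq) = p , degree-mono d≤d' deg , eq

polynomial-const : ∀ k → Polynomial 0 (λ _ → k)
polynomial-const k = ((k , 0) ∷ []) , (z≤n ∷ []) , (λ V _ → trans (ℚP.+-identityʳ _) (ℚP.*-identityʳ k))

polynomial-⊕ : ∀ {d f g} → Polynomial d f → Polynomial d g → Polynomial d (λ V → f V ⊕ g V)
polynomial-⊕ (p , degp , eqp) (q , degq , eqq) =
  p ++ q , AllP.++⁺ degp degq , (λ V 1≤V → trans (⟦⟧-++ p q V) (cong₂ _⊕_ (eqp V 1≤V) (eqq V 1≤V)))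

polynomial-scale : ∀ {d f} k → Polynomial d f → Polynomial d (λ V → k ⊗ f V)
polynomial-scale k (p , deg , eq) =
  scalePoly k p , degree-scale k deg , (λ V 1≤V → trans (⟦⟧-scale k p V) (cong (k ⊗_) (eq V 1≤V)))

polynomial-x : ∀ {d f} → Polynomial d f → Polynomial (suc d) (λ V → ι V ⊗ f V)
polynomial-x (p , deg , eq) =
  raise p , degree-raise deg , (λ V 1≤V → trans (⟦⟧-raise p V) (cong (ι V ⊗_) (eq V 1≤V)))

-- from (j + 1) C(V, j + 1) = V C(V, j) - j C(V, j)
C-polynomial : ∀ j → Polynomial j (λ V → ι (V C j))
C-polynomial zero = polynomial-const 1ℚ
C-polynomial (suc j) = polynomial-cong value (polynomial-scale κ (polynomial-⊕
  (polynomial-x (C-polynomial j)) (polynomial-scale (⊖ ι j) (polynomial-mono (ℕP.n≤1+n j) (C-polynomial j)))))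
  where
  κ : ℚ
  κ = ι⁻¹ (suc j)
  value : ∀ V → 1 ≤ V → κ ⊗ (ι V ⊗ ι (V C j) ⊕ (⊖ ι j) ⊗ ι (V C j)) ≡ ι (V C suc j)
  value V _ = begin
    κ ⊗ (ι V ⊗ ι (V C j) ⊕ (⊖ ι j) ⊗ ι (V C j))
      ≡⟨ cong (λ t → κ ⊗ (t ⊕ (⊖ ι j) ⊗ ι (V C j))) (ι-x*C-recurrence V j) ⟩
    κ ⊗ ((ι (suc j) ⊗ ι (V C suc j) ⊕ ι j ⊗ ι (V C j)) ⊕ (⊖ ι j) ⊗ ι (V C j))
      ≡⟨ solve 5 (λ k a c₁ d c₀ → k :* ((a :* c₁ :+ d :* c₀) :+ (:- d) :* c₀) := (k :* a) :* c₁) refl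
           κ (ι (suc j)) (ι (V C suc j)) (ι j) (ι (V C j)) ⟩
    (κ ⊗ ι (suc j)) ⊗ ι (V C suc j)
      ≡⟨ trans (cong (_⊗ ι (V C suc j)) (ι⁻¹-inverse (suc j))) (ℚP.*-identityˡ _) ⟩
    ι (V C suc j) ∎
    where open ≡-Reasoning

binomial-polynomial : ∀ {d} B → DegreeAtMost d B → Polynomial d ⟦ B ⟧ᶜ
binomial-polynomial [] [] = [] , [] , (λ _ _ → refl)
binomial-polynomial ((c , j) ∷ B) (j≤d ∷ deg) =
  polynomial-⊕ (polynomial-scale c (polynomial-mono j≤d (C-polynomial j))) (binomial-polynomial B deg)

faulhaber : ∀ a → Polynomial (suc a) (λ V → Σ< V (mono a))
faulhaber a with mono-binomial a
... | B , deg , eq = polynomial-cong (λ V _ → trans (sym (Σ<-⟦⟧ᶜ B V)) (Σ<-cong V (λ i → sym (eq i))))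
  (binomial-polynomial (raise B) (degree-raise deg))

⊛-mono-zero : ∀ P V → (P ⊛ mono 0) V ≡ Σ< V (P ⁺)
⊛-mono-zero P V = begin
  Σ< V (λ i → (P ⁺) i ⊗ (mono 0 ⁺) (V ∸ i)) ⊕ (P ⁺) V ⊗ (mono 0 ⁺) (V ∸ V)
    ≡⟨ cong₂ _⊕_ (Σ<-cong-< V (λ i i<V → trans (cong ((P ⁺) i ⊗_) (mono0⁺-pos (ℕP.m<n⇒0<n∸m i<V))) (ℚP.*-identityʳ _)))
                 (trans (cong (λ m → (P ⁺) V ⊗ (mono 0 ⁺) m) (ℕP.n∸n≡0 V)) (ℚP.*-zeroʳ ((P ⁺) V))) ⟩
  Σ< V (P ⁺) ⊕ 0ℚ
    ≡⟨ ℚP.+-identityʳ _ ⟩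
  Σ< V (P ⁺) ∎
  where
  open ≡-Reasoning
  mono0⁺-pos : ∀ {m} → 0 < m → (mono 0 ⁺) m ≡ 1ℚ
  mono0⁺-pos {suc m} _ = refl

Σ<-⁺ : ∀ P V → 1 ≤ V → Σ< V (P ⁺) ≡ Σ< V P ⊕ ⊖ P 0
Σ<-⁺ P (suc V) _ = begin
  Σ< (suc V) (P ⁺)                            ≡⟨ Σ<-unshift V (P ⁺) ⟩
  0ℚ ⊕ Σ< V (λ i → P (suc i))                  ≡⟨ solve 2 (λ p s → con 0ℚ :+ s := (p :+ s) :+ (:- p)) refl (P 0) _ ⟩
  (P 0 ⊕ Σ< V (λ i → P (suc i))) ⊕ ⊖ P 0      ≡⟨ cong (_⊕ ⊖ P 0) (Σ<-unshift V P) ⟨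
  Σ< (suc V) P ⊕ ⊖ P 0                        ∎
  where open ≡-Reasoning

mono-suc⁺ : ∀ e m → (mono (suc e) ⁺) m ≡ ι m ⊗ (mono e ⁺) m
mono-suc⁺ e zero = sym (ℚP.*-zeroˡ 0ℚ)
mono-suc⁺ e (suc m) = mono-suc e (suc m)

-- i^a (V-i)^(c+1) = V i^a (V-i)^c - i^(a+1) (V-i)^c
mono⊛mono-suc : ∀ a c V → (mono a ⊛ mono (suc c)) V ≡ ι V ⊗ (mono a ⊛ mono c) V ⊕ (⊖ 1ℚ) ⊗ (mono (suc a) ⊛ mono c) V
mono⊛mono-suc a c V = trans (Σ<-cong-< (suc V) (λ i i<1+V → term i (ℕP.≤-pred i<1+V)))
  (trans (Σ<-distrib-⊕ (suc V) _ _) (cong₂ _⊕_ (sym (*-distribˡ-Σ< (suc V) (ι V) _)) (sym (*-distribˡ-Σ< (suc V) (⊖ 1ℚ) _))))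
  where
  term : ∀ i → i ≤ V → (mono a ⁺) i ⊗ (mono (suc c) ⁺) (V ∸ i)
     ≡ ι V ⊗ ((mono a ⁺) i ⊗ (mono c ⁺) (V ∸ i)) ⊕ (⊖ 1ℚ) ⊗ ((mono (suc a) ⁺) i ⊗ (mono c ⁺) (V ∸ i))
  term i i≤V = trans (cong ((mono a ⁺) i ⊗_) (mono-suc⁺ c (V ∸ i)))
    (trans (solve 4 (λ x y p q → p :* (y :* q) := (x :+ y) :* (p :* q) :+ (:- con 1ℚ) :* ((x :* p) :* q)) refl
              (ι i) (ι (V ∸ i)) ((mono a ⁺) i) ((mono c ⁺) (V ∸ i)))
    (cong₂ (λ s t → s ⊗ ((mono a ⁺) i ⊗ (mono c ⁺) (V ∸ i)) ⊕ (⊖ 1ℚ) ⊗ (t ⊗ (mono c ⁺) (V ∸ i)))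
       (trans (sym (ι-homo-+ i (V ∸ i))) (cong ι (ℕP.m+[n∸m]≡n i≤V))) (sym (mono-suc⁺ a i))))

mono⊛mono-polynomial : ∀ a c → Polynomial (suc (a + c)) (mono a ⊛ mono c)
mono⊛mono-polynomial a zero = polynomial-cong value
  (polynomial-mono (ℕP.≤-reflexive (cong suc (sym (ℕP.+-identityʳ a))))
    (polynomial-⊕ (faulhaber a) (polynomial-mono z≤n (polynomial-const (⊖ mono a 0)))))
  where
  value : ∀ V → 1 ≤ V → Σ< V (mono a) ⊕ ⊖ mono a 0 ≡ (mono a ⊛ mono 0) V
  value V 1≤V = sym (trans (⊛-mono-zero (mono a) V) (Σ<-⁺ (mono a) V 1≤V))
mono⊛mono-polynomial a (suc c) = polynomial-cong (λ V _ → sym (mono⊛mono-suc a c V))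
  (polynomial-⊕ (polynomial-mono degree≤ (polynomial-x (mono⊛mono-polynomial a c)))
                (polynomial-scale (⊖ 1ℚ) (polynomial-mono degree≤ (mono⊛mono-polynomial (suc a) c))))
  where
  degree≤ : suc (suc (a + c)) ≤ suc (a + suc c)
  degree≤ = ℕP.≤-reflexive (cong suc (sym (ℕP.+-suc a c)))

⁺-linear : ∀ c P Q v → ((λ w → c ⊗ P w ⊕ Q w) ⁺) v ≡ c ⊗ (P ⁺) v ⊕ (Q ⁺) v
⁺-linear c P Q zero = sym (trans (cong (_⊕ 0ℚ) (ℚP.*-zeroʳ c)) (ℚP.+-identityˡ 0ℚ))
⁺-linear c P Q (suc v) = refl

dilate-linear : ∀ c P Q u → dilate (λ w → c ⊗ P w ⊕ Q w) u ≈ c · dilate P u ⊞ dilate Q u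
dilate-linear c P Q u i = begin
  Σ< (suc i) (λ v → 𝟙 (u * v ≡ᵇ i) ⊗ ((λ w → c ⊗ P w ⊕ Q w) ⁺) v)
    ≡⟨ Σ<-cong (suc i) (λ v → trans (cong (𝟙 (u * v ≡ᵇ i) ⊗_) (⁺-linear c P Q v))
         (solve 4 (λ b c p q → b :* (c :* p :+ q) := c :* (b :* p) :+ b :* q) refl (𝟙 (u * v ≡ᵇ i)) c ((P ⁺) v) ((Q ⁺) v))) ⟩
  Σ< (suc i) (λ v → c ⊗ (𝟙 (u * v ≡ᵇ i) ⊗ (P ⁺) v) ⊕ 𝟙 (u * v ≡ᵇ i) ⊗ (Q ⁺) v)
    ≡⟨ Σ<-distrib-⊕ (suc i) _ _ ⟩
  Σ< (suc i) (λ v → c ⊗ (𝟙 (u * v ≡ᵇ i) ⊗ (P ⁺) v)) ⊕ dilate Q u i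
    ≡⟨ cong (_⊕ dilate Q u i) (*-distribˡ-Σ< (suc i) c _) ⟨
  c ⊗ dilate P u i ⊕ dilate Q u i ∎
  where open ≡-Reasoning

dilate-null : ∀ u → dilate (λ _ → 0ℚ) u ≈ 0S
dilate-null u i = Σ<-vanish (suc i) _ (λ v _ → trans (cong (𝟙 (u * v ≡ᵇ i) ⊗_) (null⁺ v)) (ℚP.*-zeroʳ (𝟙 (u * v ≡ᵇ i))))
  where
  null⁺ : ∀ v → ((λ _ → 0ℚ) ⁺) v ≡ 0ℚ
  null⁺ zero = refl
  null⁺ (suc v) = refl

dilate-agree : ∀ {P Q} u → (∀ v → 1 ≤ v → P v ≡ Q v) → dilate P u ≈ dilate Q u
dilate-agree {P} {Q} u P≡Q = dilate-cong u agree⁺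
  where
  agree⁺ : ∀ v → (P ⁺) v ≡ (Q ⁺) v
  agree⁺ zero = refl
  agree⁺ (suc v) = P≡Q (suc v) (s≤s z≤n)

-- The quasi-shuffle product

evalExp : List (ℚ × List ℕ) → ℕ → Series
evalExp [] b = 0S
evalExp ((d , rs) ∷ X) b = d · mds (map mono rs) b ⊞ evalExp X b

evalExp-++ : ∀ X Y b → evalExp (X ++ Y) b ≈ evalExp X b ⊞ evalExp Y b
evalExp-++ [] Y b n = sym (ℚP.+-identityˡ _)
evalExp-++ ((d , rs) ∷ X) Y b n = trans (cong (d ⊗ mds (map mono rs) b n ⊕_) (evalExp-++ X Y b n))
  (sym (ℚP.+-assoc (d ⊗ mds (map mono rs) b n) (evalExp X b n) (evalExp Y b n)))

prepend : ℚ → ℕ → List (ℚ × List ℕ) → List (ℚ × List ℕ)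
prepend c e = map (λ drs → (c ⊗ proj₁ drs , e ∷ proj₂ drs))

prependPoly : Poly → List (ℚ × List ℕ) → List (ℚ × List ℕ)
prependPoly [] X = []
prependPoly ((c , e) ∷ p) X = prepend c e X ++ prependPoly p X

prepend-zero : ∀ c e X → evalExp (prepend c e X) 0 ≈ 0S
prepend-zero c e [] n = refl
prepend-zero c e ((d , rs) ∷ X) n = trans (cong₂ _⊕_ (ℚP.*-zeroʳ (c ⊗ d)) (prepend-zero c e X n)) (ℚP.+-identityˡ 0ℚ)

prependPoly-zero : ∀ p X → evalExp (prependPoly p X) 0 ≈ 0S
prependPoly-zero [] X n = refl
prependPoly-zero ((c , e) ∷ p) X n = trans (evalExp-++ (prepend c e X) (prependPoly p X) 0 n)
  (trans (cong₂ _⊕_ (prepend-zero c e X n) (prependPoly-zero p X n)) (ℚP.+-identityˡ 0ℚ))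

prepend-suc : ∀ c e X b →
  evalExp (prepend c e X) (suc b) ≈ evalExp (prepend c e X) b ⊞ (c · dilate (mono e) b) ⋆ evalExp X b
prepend-suc c e [] b n = sym (trans (cong (0ℚ ⊕_) (⋆-zeroʳ (c · dilate (mono e) b) n)) (ℚP.+-identityˡ 0ℚ))
prepend-suc c e ((d , rs) ∷ X) b n = begin
  (c ⊗ d) ⊗ (M n ⊕ (D ⋆ N) n) ⊕ evalExp (prepend c e X) (suc b) n
    ≡⟨ cong ((c ⊗ d) ⊗ (M n ⊕ (D ⋆ N) n) ⊕_) (prepend-suc c e X b n) ⟩
  (c ⊗ d) ⊗ (M n ⊕ (D ⋆ N) n) ⊕ (evalExp (prepend c e X) b n ⊕ ((c · D) ⋆ E) n)
    ≡⟨ solve 6 (λ c d x y z w → (c :* d) :* (x :+ y) :+ (z :+ w) := ((c :* d) :* x :+ z) :+ (c :* (d :* y) :+ w))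
         refl c d (M n) ((D ⋆ N) n) (evalExp (prepend c e X) b n) (((c · D) ⋆ E) n) ⟩
  ((c ⊗ d) ⊗ M n ⊕ evalExp (prepend c e X) b n) ⊕ (c ⊗ (d ⊗ (D ⋆ N) n) ⊕ ((c · D) ⋆ E) n)
    ≡⟨ cong (((c ⊗ d) ⊗ M n ⊕ evalExp (prepend c e X) b n) ⊕_) distribute ⟨
  ((c ⊗ d) ⊗ M n ⊕ evalExp (prepend c e X) b n) ⊕ ((c · D) ⋆ (d · N ⊞ E)) n ∎
  where
  open ≡-Reasoning
  D M N E : Series
  D = dilate (mono e) b
  M = mds (mono e ∷ map mono rs) b
  N = mds (map mono rs) b
  E = evalExp X b
  distribute : ((c · D) ⋆ (d · N ⊞ E)) n ≡ c ⊗ (d ⊗ (D ⋆ N) n) ⊕ ((c · D) ⋆ E) n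
  distribute = trans (⋆-distribˡ-⊞ (c · D) (d · N) E n)
    (cong (_⊕ ((c · D) ⋆ E) n) (trans (·-⋆-assoc c D (d · N) n) (cong (c ⊗_) (⋆-·-comm d D N n))))

prependPoly-suc : ∀ p X b →
  evalExp (prependPoly p X) (suc b) ≈ evalExp (prependPoly p X) b ⊞ dilate ⟦ p ⟧ b ⋆ evalExp X b
prependPoly-suc [] X b n = sym (trans (cong (0ℚ ⊕_)
  (trans (⋆-cong (dilate-null b) (≈-refl {evalExp X b}) n) (⋆-zeroˡ (evalExp X b) n))) (ℚP.+-identityˡ 0ℚ))
prependPoly-suc ((c , e) ∷ p) X b n = begin
  evalExp (prepend c e X ++ prependPoly p X) (suc b) n
    ≡⟨ evalExp-++ (prepend c e X) (prependPoly p X) (suc b) n ⟩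
  evalExp (prepend c e X) (suc b) n ⊕ evalExp (prependPoly p X) (suc b) n
    ≡⟨ cong₂ _⊕_ (prepend-suc c e X b n) (prependPoly-suc p X b n) ⟩
  (P b n ⊕ ((c · D) ⋆ E) n) ⊕ (Q b n ⊕ (dilate ⟦ p ⟧ b ⋆ E) n)
    ≡⟨ solve 4 (λ a p m q → (a :+ p) :+ (m :+ q) := (a :+ m) :+ (p :+ q)) refl
         (P b n) (((c · D) ⋆ E) n) (Q b n) ((dilate ⟦ p ⟧ b ⋆ E) n) ⟩
  (P b n ⊕ Q b n) ⊕ (((c · D) ⋆ E) n ⊕ (dilate ⟦ p ⟧ b ⋆ E) n)
    ≡⟨ cong₂ _⊕_ (evalExp-++ (prepend c e X) (prependPoly p X) b n) (⋆-distribʳ-⊞ E (c · D) (dilate ⟦ p ⟧ b) n) ⟨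
  evalExp (prepend c e X ++ prependPoly p X) b n ⊕ ((c · D ⊞ dilate ⟦ p ⟧ b) ⋆ E) n
    ≡⟨ cong (evalExp (prepend c e X ++ prependPoly p X) b n ⊕_)
         (⋆-cong (≈-sym (dilate-linear c (mono e) ⟦ p ⟧ b)) (≈-refl {E}) n) ⟩
  evalExp (prepend c e X ++ prependPoly p X) b n ⊕ (dilate ⟦ (c , e) ∷ p ⟧ b ⋆ E) n ∎
  where
  open ≡-Reasoning
  D E : Series
  D = dilate (mono e) b
  E = evalExp X b
  P Q : ℕ → Series
  P = evalExp (prepend c e X)
  Q = evalExp (prependPoly p X)

monomial : ℕ → Poly
monomial a = (1ℚ , a) ∷ []

⟦monomial⟧ : ∀ a v → ⟦ monomial a ⟧ v ≡ mono a v
⟦monomial⟧ a v = trans (ℚP.+-identityʳ _) (ℚP.*-identityˡ _)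

conv-poly : ℕ → ℕ → Poly
conv-poly a c = proj₁ (mono⊛mono-polynomial a c)

dilate-conv-poly : ∀ a c u → dilate ⟦ conv-poly a c ⟧ u ≈ dilate (mono a) u ⋆ dilate (mono c) u
dilate-conv-poly a c u = ≈-trans (dilate-agree u (proj₂ (proj₂ (mono⊛mono-polynomial a c))))
  (≈-sym (dilate-⋆-dilate (mono a) (mono c) u))

-- The largest index comes from the first factor, from the second, or from both (see dilate-⋆-dilate).
quasiShuffle : List ℕ → List ℕ → List (ℚ × List ℕ)
quasiShuffle [] B = (1ℚ , B) ∷ []
quasiShuffle (a ∷ A) [] = (1ℚ , a ∷ A) ∷ []
quasiShuffle (a ∷ A) (c ∷ B) =
  prependPoly (monomial a) (quasiShuffle A (c ∷ B)) ++
  (prependPoly (monomial c) (quasiShuffle (a ∷ A) B) ++ prependPoly (conv-poly a c) (quasiShuffle A B))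

evalExp-single : ∀ rs b → evalExp ((1ℚ , rs) ∷ []) b ≈ mds (map mono rs) b
evalExp-single rs b n = trans (ℚP.+-identityʳ _) (ℚP.*-identityˡ _)

evalExp-++₃ : ∀ X Y Z b → evalExp (X ++ (Y ++ Z)) b ≈ evalExp X b ⊞ (evalExp Y b ⊞ evalExp Z b)
evalExp-++₃ X Y Z b = ≈-trans (evalExp-++ X (Y ++ Z) b) (⊞-cong (≈-refl {evalExp X b}) (evalExp-++ Y Z b))

mds-product : ∀ b A B → mds (map mono A) b ⋆ mds (map mono B) b ≈ evalExp (quasiShuffle A B) b
mds-product b [] B = ≈-trans (⋆-identityˡ (mds (map mono B) b)) (≈-sym (evalExp-single B b))
mds-product b (a ∷ A) [] = ≈-trans (⋆-identityʳ (mds (map mono (a ∷ A)) b)) (≈-sym (evalExp-single (a ∷ A) b))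
mds-product zero (a ∷ A) (c ∷ B) n = trans (⋆-zeroˡ 0S n) (sym (trans
  (evalExp-++₃ (prependPoly (monomial a) (quasiShuffle A (c ∷ B)))
               (prependPoly (monomial c) (quasiShuffle (a ∷ A) B)) (prependPoly (conv-poly a c) (quasiShuffle A B)) 0 n)
  (trans (cong₂ _⊕_ (prependPoly-zero (monomial a) (quasiShuffle A (c ∷ B)) n)
    (trans (cong₂ _⊕_ (prependPoly-zero (monomial c) (quasiShuffle (a ∷ A) B) n)
                      (prependPoly-zero (conv-poly a c) (quasiShuffle A B) n)) (ℚP.+-identityˡ 0ℚ)))
  (ℚP.+-identityˡ 0ℚ))))
mds-product (suc b) (a ∷ A) (c ∷ B) n = begin
  ((X ⊞ Y) ⋆ (U ⊞ V)) n
    ≡⟨ trans (⋆-distribʳ-⊞ (U ⊞ V) X Y n) (cong₂ _⊕_ (⋆-distribˡ-⊞ X U V n) (⋆-distribˡ-⊞ Y U V n)) ⟩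
  ((X ⋆ U) n ⊕ (X ⋆ V) n) ⊕ ((Y ⋆ U) n ⊕ (Y ⋆ V) n)
    ≡⟨ cong (λ t → (t ⊕ (X ⋆ V) n) ⊕ ((Y ⋆ U) n ⊕ (Y ⋆ V) n)) (sym (old n)) ⟩
  ((m₁ b n ⊕ (m₂ b n ⊕ m₃ b n)) ⊕ (X ⋆ V) n) ⊕ ((Y ⋆ U) n ⊕ (Y ⋆ V) n)
    ≡⟨ solve 6 (λ a₁ a₂ a₃ q r s → ((a₁ :+ (a₂ :+ a₃)) :+ q) :+ (r :+ s) := (a₁ :+ r) :+ ((a₂ :+ q) :+ (a₃ :+ s))) refl
         (m₁ b n) (m₂ b n) (m₃ b n) ((X ⋆ V) n) ((Y ⋆ U) n) ((Y ⋆ V) n) ⟩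
  (m₁ b n ⊕ (Y ⋆ U) n) ⊕ ((m₂ b n ⊕ (X ⋆ V) n) ⊕ (m₃ b n ⊕ (Y ⋆ V) n))
    ≡⟨ cong₂ _⊕_ (new₁ n) (cong₂ _⊕_ (new₂ n) (new₃ n)) ⟨
  m₁ (suc b) n ⊕ (m₂ (suc b) n ⊕ m₃ (suc b) n)
    ≡⟨ evalExp-++₃ shuffle₁ shuffle₂ shuffle₃ (suc b) n ⟨
  evalExp (quasiShuffle (a ∷ A) (c ∷ B)) (suc b) n ∎
  where
  open ≡-Reasoning
  Da Dc GA GB X Y U V : Series
  Da = dilate (mono a) b
  Dc = dilate (mono c) b
  GA = mds (map mono A) b
  GB = mds (map mono B) b
  X = mds (map mono (a ∷ A)) b
  Y = Da ⋆ GA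
  U = mds (map mono (c ∷ B)) b
  V = Dc ⋆ GB
  shuffle₁ shuffle₂ shuffle₃ : List (ℚ × List ℕ)
  shuffle₁ = prependPoly (monomial a) (quasiShuffle A (c ∷ B))
  shuffle₂ = prependPoly (monomial c) (quasiShuffle (a ∷ A) B)
  shuffle₃ = prependPoly (conv-poly a c) (quasiShuffle A B)
  m₁ m₂ m₃ : ℕ → Series
  m₁ = evalExp shuffle₁
  m₂ = evalExp shuffle₂
  m₃ = evalExp shuffle₃
  old : m₁ b ⊞ (m₂ b ⊞ m₃ b) ≈ X ⋆ U
  old = ≈-trans (≈-sym (evalExp-++₃ shuffle₁ shuffle₂ shuffle₃ b)) (≈-sym (mds-product b (a ∷ A) (c ∷ B)))
  new₁ : m₁ (suc b) ≈ m₁ b ⊞ Y ⋆ U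
  new₁ = ≈-trans (prependPoly-suc (monomial a) (quasiShuffle A (c ∷ B)) b) (⊞-cong (≈-refl {m₁ b})
    (≈-trans (⋆-cong (dilate-agree b (λ v _ → ⟦monomial⟧ a v)) (≈-sym (mds-product b A (c ∷ B))))
             (≈-sym (⋆-assoc Da GA U))))
  new₂ : m₂ (suc b) ≈ m₂ b ⊞ X ⋆ V
  new₂ = ≈-trans (prependPoly-suc (monomial c) (quasiShuffle (a ∷ A) B) b) (⊞-cong (≈-refl {m₂ b})
    (≈-trans (⋆-cong (dilate-agree b (λ v _ → ⟦monomial⟧ c v)) (≈-sym (mds-product b (a ∷ A) B)))
             (x∙yz≈y∙xz Dc X GB)))
  new₃ : m₃ (suc b) ≈ m₃ b ⊞ Y ⋆ V
  new₃ = ≈-trans (prependPoly-suc (conv-poly a c) (quasiShuffle A B) b) (⊞-cong (≈-refl {m₃ b})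
    (≈-trans (⋆-cong (dilate-conv-poly a c b) (≈-sym (mds-product b A B)))
             (interchange Da Dc GA GB)))

σ-series-product : ∀ A B → σ-series A ⋆ σ-series B ≈ (λ n → evalExp (quasiShuffle A B) (suc n) n)
σ-series-product A B n = begin
  (σ-series A ⋆ σ-series B) n
    ≡⟨ ⋆-coeff (σ-series A) (σ-series B) n ⟩
  Σ< (suc n) (λ i → σ-series A i ⊗ σ-series B (n ∸ i))
    ≡⟨ Σ<-cong-< (suc n) (λ i i<1+n → cong₂ _⊗_ (mds-stable-≤ (map mono A) i n (ℕP.≤-pred i<1+n))
                                                (mds-stable-≤ (map mono B) (n ∸ i) n (ℕP.m∸n≤m n i))) ⟩
  Σ< (suc n) (λ i → GA i ⊗ GB (n ∸ i))
    ≡⟨ ⋆-coeff GA GB n ⟨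
  (GA ⋆ GB) n
    ≡⟨ mds-product (suc n) A B n ⟩
  evalExp (quasiShuffle A B) (suc n) n ∎
  where
  open ≡-Reasoning
  GA GB : Series
  GA = mds (map mono A) (suc n)
  GB = mds (map mono B) (suc n)

bracket-by-σ : ∀ ss n → bracket ss n ≡ ι⁻¹ (factProd ss) {{factProd-nz ss}} ⊗ σ-series (map pred ss) n
bracket-by-σ ss n = ι⁻¹-cancel (factProd ss) {{factProd-nz ss}} (bracket-σ-series ss n)

map-pred-suc : ∀ rs → map pred (map suc rs) ≡ rs
map-pred-suc [] = refl
map-pred-suc (r ∷ rs) = cong (r ∷_) (map-pred-suc rs)

map-suc-pred : ∀ ss → IsIndex ss → map suc (map pred ss) ≡ ss
map-suc-pred [] [] = refl
map-suc-pred (suc s ∷ ss) (_ ∷ h) = cong (suc s ∷_) (map-suc-pred ss h)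

toBrackets : List (ℚ × List ℕ) → LinComb
toBrackets [] = []
toBrackets ((d , rs) ∷ X) = (d ⊗ ι (factProd (map suc rs)) , map suc rs) ∷ toBrackets X

evalLC-toBrackets : ∀ X n → evalLC (toBrackets X) n ≡ evalExp X (suc n) n
evalLC-toBrackets [] n = refl
evalLC-toBrackets ((d , rs) ∷ X) n = cong₂ _⊕_ term (evalLC-toBrackets X n)
  where
  term : (d ⊗ ι (factProd (map suc rs))) ⊗ bracket (map suc rs) n ≡ d ⊗ σ-series rs n
  term = trans (solve 3 (λ d f b → (d :* f) :* b := d :* (b :* f)) refl d (ι (factProd (map suc rs))) (bracket (map suc rs) n))
    (cong (d ⊗_) (trans (bracket-σ-series (map suc rs) n) (cong (λ D → σ-series D n) (map-pred-suc rs))))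

scaleLC : ℚ → LinComb → LinComb
scaleLC k = map (λ cs → (k ⊗ proj₁ cs , proj₂ cs))

evalLC-scale : ∀ k lc n → evalLC (scaleLC k lc) n ≡ k ⊗ evalLC lc n
evalLC-scale k [] n = sym (ℚP.*-zeroʳ k)
evalLC-scale k ((c , ss) ∷ lc) n = trans (cong ((k ⊗ c) ⊗ bracket ss n ⊕_) (evalLC-scale k lc n))
  (solve 4 (λ k c b r → (k :* c) :* b :+ k :* r := k :* (c :* b :+ r)) refl k c (bracket ss n) (evalLC lc n))

evalLC-++ : ∀ X Y n → evalLC (X ++ Y) n ≡ evalLC X n ⊕ evalLC Y n
evalLC-++ [] Y n = sym (ℚP.+-identityˡ _)
evalLC-++ ((c , ss) ∷ X) Y n = trans (cong (c ⊗ bracket ss n ⊕_) (evalLC-++ X Y n))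
  (sym (ℚP.+-assoc (c ⊗ bracket ss n) (evalLC X n) (evalLC Y n)))

bracketProduct : List ℕ → List ℕ → LinComb
bracketProduct ss ts = scaleLC (ι⁻¹ (factProd ss) {{factProd-nz ss}} ⊗ ι⁻¹ (factProd ts) {{factProd-nz ts}})
  (toBrackets (quasiShuffle (map pred ss) (map pred ts)))

bracket-⋆ : ∀ ss ts → bracket ss ⋆ bracket ts ≈ evalLC (bracketProduct ss ts)
bracket-⋆ ss ts n = begin
  (bracket ss ⋆ bracket ts) n
    ≡⟨ ⋆-cong (bracket-by-σ ss) (bracket-by-σ ts) n ⟩
  ((κs · σ-series A) ⋆ (κt · σ-series B)) n
    ≡⟨ trans (·-⋆-assoc κs (σ-series A) (κt · σ-series B) n) (cong (κs ⊗_) (⋆-·-comm κt (σ-series A) (σ-series B) n)) ⟩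
  κs ⊗ (κt ⊗ (σ-series A ⋆ σ-series B) n)
    ≡⟨ cong (λ t → κs ⊗ (κt ⊗ t)) (trans (σ-series-product A B n) (sym (evalLC-toBrackets (quasiShuffle A B) n))) ⟩
  κs ⊗ (κt ⊗ evalLC (toBrackets (quasiShuffle A B)) n)
    ≡⟨ ℚP.*-assoc κs κt _ ⟨
  (κs ⊗ κt) ⊗ evalLC (toBrackets (quasiShuffle A B)) n
    ≡⟨ evalLC-scale (κs ⊗ κt) (toBrackets (quasiShuffle A B)) n ⟨
  evalLC (bracketProduct ss ts) n ∎
  where
  open ≡-Reasoning
  A B : List ℕ
  A = map pred ss
  B = map pred ts
  κs κt : ℚ
  κs = ι⁻¹ (factProd ss) {{factProd-nz ss}}
  κt = ι⁻¹ (factProd ts) {{factProd-nz ts}}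

rowLC : ℚ → List ℕ → LinComb → LinComb
rowLC c ss [] = []
rowLC c ss ((d , ts) ∷ l) = scaleLC (c ⊗ d) (bracketProduct ss ts) ++ rowLC c ss l

productLC : LinComb → LinComb → LinComb
productLC [] l₂ = []
productLC ((c , ss) ∷ l₁) l₂ = rowLC c ss l₂ ++ productLC l₁ l₂

evalLC-rowLC : ∀ c ss l → (c · bracket ss) ⋆ evalLC l ≈ evalLC (rowLC c ss l)
evalLC-rowLC c ss [] = ⋆-zeroʳ (c · bracket ss)
evalLC-rowLC c ss ((d , ts) ∷ l) n = begin
  ((c · bracket ss) ⋆ (d · bracket ts ⊞ evalLC l)) n
    ≡⟨ ⋆-distribˡ-⊞ (c · bracket ss) (d · bracket ts) (evalLC l) n ⟩
  ((c · bracket ss) ⋆ (d · bracket ts)) n ⊕ ((c · bracket ss) ⋆ evalLC l) n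
    ≡⟨ cong₂ _⊕_ single (evalLC-rowLC c ss l n) ⟩
  evalLC (scaleLC (c ⊗ d) (bracketProduct ss ts)) n ⊕ evalLC (rowLC c ss l) n
    ≡⟨ evalLC-++ (scaleLC (c ⊗ d) (bracketProduct ss ts)) (rowLC c ss l) n ⟨
  evalLC (rowLC c ss ((d , ts) ∷ l)) n ∎
  where
  open ≡-Reasoning
  single : ((c · bracket ss) ⋆ (d · bracket ts)) n ≡ evalLC (scaleLC (c ⊗ d) (bracketProduct ss ts)) n
  single = begin
    ((c · bracket ss) ⋆ (d · bracket ts)) n
      ≡⟨ trans (·-⋆-assoc c (bracket ss) (d · bracket ts) n) (cong (c ⊗_) (⋆-·-comm d (bracket ss) (bracket ts) n)) ⟩
    c ⊗ (d ⊗ (bracket ss ⋆ bracket ts) n)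
      ≡⟨ trans (sym (ℚP.*-assoc c d _)) (cong ((c ⊗ d) ⊗_) (bracket-⋆ ss ts n)) ⟩
    (c ⊗ d) ⊗ evalLC (bracketProduct ss ts) n
      ≡⟨ evalLC-scale (c ⊗ d) (bracketProduct ss ts) n ⟨
    evalLC (scaleLC (c ⊗ d) (bracketProduct ss ts)) n ∎

evalLC-productLC : ∀ l₁ l₂ → evalLC l₁ ⋆ evalLC l₂ ≈ evalLC (productLC l₁ l₂)
evalLC-productLC [] l₂ = ⋆-zeroˡ (evalLC l₂)
evalLC-productLC ((c , ss) ∷ l₁) l₂ n =
  trans (⋆-distribʳ-⊞ (evalLC l₂) (c · bracket ss) (evalLC l₁) n)
  (trans (cong₂ _⊕_ (evalLC-rowLC c ss l₂ n) (evalLC-productLC l₁ l₂ n))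
  (sym (evalLC-++ (rowLC c ss l₂) (productLC l₁ l₂) n)))

-- Weight and length bounds

Bounded : ℕ → ℕ → ℚ × List ℕ → Set
Bounded k l drs = weight (map suc (proj₂ drs)) ≤ k × length (proj₂ drs) ≤ l

FilIndex : ℕ → ℕ → List ℕ → Set
FilIndex k l ss = IsIndex ss × weight ss ≤ k × length ss ≤ l

FilTerm : ℕ → ℕ → ℚ × List ℕ → Set
FilTerm k l cs = FilIndex k l (proj₂ cs)

bounded-mono : ∀ {k k' l l'} → k ≤ k' → l ≤ l' → ∀ {X} → All (Bounded k l) X → All (Bounded k' l') X
bounded-mono k≤k' l≤l' = All.map (λ (w≤k , n≤l) → ℕP.≤-trans w≤k k≤k' , ℕP.≤-trans n≤l l≤l')

filTerm-mono : ∀ {k k' l l'} → k ≤ k' → l ≤ l' → ∀ {X} → All (FilTerm k l) X → All (FilTerm k' l') X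
filTerm-mono k≤k' l≤l' = All.map (λ (idx , w≤k , n≤l) → idx , ℕP.≤-trans w≤k k≤k' , ℕP.≤-trans n≤l l≤l')

prepend-bounded : ∀ {k l} c e {X} → All (Bounded k l) X → All (Bounded (suc e + k) (suc l)) (prepend c e X)
prepend-bounded c e h = AllP.map⁺ (All.map (λ (w≤k , n≤l) → ℕP.+-monoʳ-≤ (suc e) w≤k , s≤s n≤l) h)

prependPoly-bounded : ∀ {d k l} p X → DegreeAtMost d p → All (Bounded k l) X →
  All (Bounded (suc d + k) (suc l)) (prependPoly p X)
prependPoly-bounded [] X [] h = []
prependPoly-bounded {k = k} ((c , e) ∷ p) X (e≤d ∷ deg) h = AllP.++⁺
  (bounded-mono (ℕP.+-monoˡ-≤ k (s≤s e≤d)) ℕP.≤-refl (prepend-bounded c e h)) (prependPoly-bounded p X deg h)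

BoundedShuffle : List ℕ → List ℕ → Set
BoundedShuffle A B =
  All (Bounded (weight (map suc A) + weight (map suc B)) (length A + length B)) (quasiShuffle A B)

quasiShuffle-bounded-step : ∀ a A c B → BoundedShuffle A (c ∷ B) → BoundedShuffle (a ∷ A) B → BoundedShuffle A B →
  BoundedShuffle (a ∷ A) (c ∷ B)
quasiShuffle-bounded-step a A c B bounded-A-cB bounded-aA-B bounded-A-B = AllP.++⁺ bounded₁ (AllP.++⁺ bounded₂ bounded₃)
  where
  wA wB lA lB : ℕ
  wA = weight (map suc A)
  wB = weight (map suc B)
  lA = length A
  lB = length B
  Target : ℚ × List ℕ → Set
  Target = Bounded (weight (map suc (a ∷ A)) + weight (map suc (c ∷ B))) (length (a ∷ A) + length (c ∷ B))
  bounded₁ : All Target (prependPoly (monomial a) (quasiShuffle A (c ∷ B)))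
  bounded₁ = bounded-mono (ℕP.≤-reflexive (sym (ℕP.+-assoc (suc a) wA (suc c + wB)))) ℕP.≤-refl
    (prependPoly-bounded (monomial a) (quasiShuffle A (c ∷ B)) (ℕP.≤-refl ∷ []) bounded-A-cB)
  bounded₂ : All Target (prependPoly (monomial c) (quasiShuffle (a ∷ A) B))
  bounded₂ = bounded-mono
    (ℕP.≤-reflexive (ℕsolve 4 (λ c a x y → (ℕcon 1 ℕ:+ c) ℕ:+ ((ℕcon 1 ℕ:+ a ℕ:+ x) ℕ:+ y)
                                           ℕ:= (ℕcon 1 ℕ:+ a ℕ:+ x) ℕ:+ (ℕcon 1 ℕ:+ c ℕ:+ y)) refl c a wA wB))
    (ℕP.≤-reflexive (sym (ℕP.+-suc (suc lA) lB)))
    (prependPoly-bounded (monomial c) (quasiShuffle (a ∷ A) B) (ℕP.≤-refl ∷ []) bounded-aA-B)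
  bounded₃ : All Target (prependPoly (conv-poly a c) (quasiShuffle A B))
  bounded₃ = bounded-mono
    (ℕP.≤-reflexive (ℕsolve 4 (λ a c x y → (ℕcon 2 ℕ:+ (a ℕ:+ c)) ℕ:+ (x ℕ:+ y)
                                           ℕ:= (ℕcon 1 ℕ:+ a ℕ:+ x) ℕ:+ (ℕcon 1 ℕ:+ c ℕ:+ y)) refl a c wA wB))
    (s≤s (ℕP.+-monoʳ-≤ lA (ℕP.n≤1+n lB)))
    (prependPoly-bounded (conv-poly a c) (quasiShuffle A B) (proj₁ (proj₂ (mono⊛mono-polynomial a c))) bounded-A-B)

quasiShuffle-bounded : ∀ A B → BoundedShuffle A B
quasiShuffle-bounded [] B = (ℕP.≤-refl , ℕP.≤-refl) ∷ []
quasiShuffle-bounded (a ∷ A) [] = (ℕP.m≤m+n _ 0 , ℕP.m≤m+n _ 0) ∷ []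
quasiShuffle-bounded (a ∷ A) (c ∷ B) = quasiShuffle-bounded-step a A c B
  (quasiShuffle-bounded A (c ∷ B)) (quasiShuffle-bounded (a ∷ A) B) (quasiShuffle-bounded A B)

toBrackets-filTerm : ∀ {k l} X → All (Bounded k l) X → All (FilTerm k l) (toBrackets X)
toBrackets-filTerm [] [] = []
toBrackets-filTerm {l = l} ((d , rs) ∷ X) ((w≤k , n≤l) ∷ h) =
  (AllP.map⁺ (All.universal (λ _ → s≤s z≤n) rs) , w≤k , subst (_≤ l) (sym (length-map suc rs)) n≤l)
  ∷ toBrackets-filTerm X h

bracketProduct-filTerm : ∀ {k₁ k₂ l₁ l₂} ss ts → FilIndex k₁ l₁ ss → FilIndex k₂ l₂ ts →
  All (FilTerm (k₁ + k₂) (l₁ + l₂)) (bracketProduct ss ts)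
bracketProduct-filTerm {k₁} {k₂} {l₁} {l₂} ss ts (idx₁ , w₁ , n₁) (idx₂ , w₂ , n₂) = AllP.map⁺ (toBrackets-filTerm (quasiShuffle (map pred ss) (map pred ts))
  (bounded-mono (ℕP.+-mono-≤ (weight-bound ss idx₁ w₁) (weight-bound ts idx₂ w₂))
                (ℕP.+-mono-≤ (subst (_≤ l₁) (sym (length-map pred ss)) n₁) (subst (_≤ l₂) (sym (length-map pred ts)) n₂))
                (quasiShuffle-bounded (map pred ss) (map pred ts))))
  where
  weight-bound : ∀ {k} ss → IsIndex ss → weight ss ≤ k → weight (map suc (map pred ss)) ≤ k
  weight-bound {k} ss idx w = subst (λ xs → weight xs ≤ k) (sym (map-suc-pred ss idx)) w

rowLC-filTerm : ∀ {k₁ k₂ l₁ l₂} c ss l → FilIndex k₁ l₁ ss → All (FilTerm k₂ l₂) l →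
  All (FilTerm (k₁ + k₂) (l₁ + l₂)) (rowLC c ss l)
rowLC-filTerm c ss [] _ [] = []
rowLC-filTerm c ss ((d , ts) ∷ l) fil (fil' ∷ fils) =
  AllP.++⁺ (AllP.map⁺ (bracketProduct-filTerm ss ts fil fil')) (rowLC-filTerm c ss l fil fils)

productLC-filTerm : ∀ {k₁ k₂ l₁ l₂} lc₁ lc₂ → All (FilTerm k₁ l₁) lc₁ → All (FilTerm k₂ l₂) lc₂ →
  All (FilTerm (k₁ + k₂) (l₁ + l₂)) (productLC lc₁ lc₂)
productLC-filTerm [] lc₂ [] _ = []
productLC-filTerm ((c , ss) ∷ lc₁) lc₂ (fil ∷ fils) fils₂ =
  AllP.++⁺ (rowLC-filTerm c ss lc₂ fil fils₂) (productLC-filTerm lc₁ lc₂ fils fils₂)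

InFil-⋆ : (k₁ k₂ l₁ l₂ : ℕ) (f g : Series) → InFil k₁ l₁ f → InFil k₂ l₂ g → InFil (k₁ + k₂) (l₁ + l₂) (f ⋆ g)
InFil-⋆ k₁ k₂ l₁ l₂ f g (lc₁ , fil₁ , f≡) (lc₂ , fil₂ , g≡) =
  productLC lc₁ lc₂ , productLC-filTerm lc₁ lc₂ fil₁ fil₂ , (λ n → trans (⋆-cong f≡ g≡ n) (evalLC-productLC lc₁ lc₂ n))

totalWeight totalLength : LinComb → ℕ
totalWeight [] = 0
totalWeight ((c , ss) ∷ lc) = weight ss + totalWeight lc
totalLength [] = 0
totalLength ((c , ss) ∷ lc) = length ss + totalLength lc

indices-filTerm : ∀ lc → All (λ cs → IsIndex (proj₂ cs)) lc → All (FilTerm (totalWeight lc) (totalLength lc)) lc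
indices-filTerm [] [] = []
indices-filTerm ((c , ss) ∷ lc) (idx ∷ idxs) =
  (idx , ℕP.m≤m+n (weight ss) (totalWeight lc) , ℕP.m≤m+n (length ss) (totalLength lc))
  ∷ filTerm-mono (ℕP.m≤n+m (totalWeight lc) (weight ss)) (ℕP.m≤n+m (totalLength lc) (length ss)) (indices-filTerm lc idxs)

InMD⇒InFil : ∀ {f} → InMD f → Σ ℕ (λ k → Σ ℕ (λ l → InFil k l f))
InMD⇒InFil (lc , idxs , f≡) = totalWeight lc , totalLength lc , lc , indices-filTerm lc idxs , f≡

InFil⇒InMD : ∀ {k l f} → InFil k l f → InMD f
InFil⇒InMD (lc , fils , f≡) = lc , All.map proj₁ fils , f≡

InMD-⋆ : (f g : Series) → InMD f → InMD g → InMD (f ⋆ g)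
InMD-⋆ f g f∈MD g∈MD with InMD⇒InFil f∈MD | InMD⇒InFil g∈MD
... | k₁ , l₁ , f∈Fil | k₂ , l₂ , g∈Fil = InFil⇒InMD (InFil-⋆ k₁ k₂ l₁ l₂ f g f∈Fil g∈Fil)

mainTheorem1 : ((f g : Series) → InMD f → InMD g → InMD (f ⋆ g))
    × ((k₁ k₂ l₁ l₂ : ℕ) (f g : Series) → InFil k₁ l₁ f → InFil k₂ l₂ g
        → InFil (k₁ + k₂) (l₁ + l₂) (f ⋆ g))
mainTheorem1 = InMD-⋆ , InFil-⋆
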